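{- Let $n\ge 3$ be an integer and let $\mathtt B_n=[b_{ij}]_{0\le i,j\le n}\in\{0,1\}^{(n+1)\times(n+1)}$ be defined by $b_{ij}=1$ iff ($i=0$ and $j=0$) or ($i=n$ and $j=0$) or $j=i+1$ or $i+j=n+1$, and let $Q_n(\lambda)=\det(\mathtt B_n-\lambda I)$. Then, if $n$ is odd, $$Q_n(\lambda)=(\lambda-2)\sum_{k=1}^{\lfloor n/4\rfloor+1}(-1)^{k-1}\binom{\frac{n+1}{2}-k}{k-1}\lambda^{n-2k+2},$$ and if $n$ is even, $$Q_n(\lambda)=-\sum_{k=1}^{\lfloor (n+3)/4\rfloor+2}(-1)^{k-1}\left(\binom{\frac n2-k+2}{k-1}+\binom{\frac n2-k+2}{k-2}\lambda\right)\lambda^{n-2k+3}.$$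
   Context: Binomial coefficients $\binom{a}{b}$ with integer $a\ge0$ are taken to be $0$ when $b<0$ or $b>a$. -}

module Defs where

open import Data.Nat as ℕ using (ℕ; zero; suc)
open import Data.Nat.Combinatorics using (_C_)
open import Data.Integer as ℤ using (ℤ; +_; -[1+_])
open import Data.Fin using (Fin; zero; suc; toℕ; punchIn)
open import Data.Bool using (Bool; true; false; _∨_; _∧_)

Matrix : ℕ → Set
Matrix n = Fin n → Fin n → ℤ

sumFin : (n : ℕ) → (Fin n → ℤ) → ℤ
sumFin zero    f = + 0
sumFin (suc n) f = f zero ℤ.+ sumFin n (λ i → f (suc i))

sgn : ℕ → ℤ
sgn zero    = + 1
sgn (suc k) = ℤ.- sgn k

det : (n : ℕ) → Matrix n → ℤ
det zero    M = + 1
det (suc n) M =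
  sumFin (suc n) (λ j → sgn (toℕ j) ℤ.* (M zero j ℤ.* det n (λ i k → M (suc i) (punchIn j k))))

idM : (n : ℕ) → Matrix n
idM n i j = if⁇ (toℕ i ℕ.≡ᵇ toℕ j)
  where
  if⁇ : Bool → ℤ
  if⁇ true  = + 1
  if⁇ false = + 0

subScalar : (n : ℕ) → Matrix n → ℤ → Matrix n
subScalar n M x i j = M i j ℤ.- x ℤ.* idM n i j

bEntry : ℕ → ℕ → ℕ → Bool
bEntry n i j =
  ((i ℕ.≡ᵇ 0) ∧ (j ℕ.≡ᵇ 0)) ∨ ((i ℕ.≡ᵇ n) ∧ (j ℕ.≡ᵇ 0))
  ∨ (j ℕ.≡ᵇ suc i) ∨ ((i ℕ.+ j) ℕ.≡ᵇ suc n)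

boolℤ : Bool → ℤ
boolℤ true  = + 1
boolℤ false = + 0

B : (n : ℕ) → Matrix (suc n)
B n i j = boolℤ (bEntry n (toℕ i) (toℕ j))

Q : ℕ → ℤ → ℤ
Q n x = det (suc n) (subScalar (suc n) (B n) x)

-- Binomial coefficient with integer lower index; 0 for negative lower
-- index (and 0 for lower index > upper, as in _C_).
binom : ℕ → ℤ → ℤ
binom a (+ b)    = + (a C b)
binom a -[1+ _ ] = + 0

sum1 : ℕ → (ℕ → ℤ) → ℤ
sum1 zero    f = + 0
sum1 (suc K) f = sum1 K f ℤ.+ f (suc K)

module Submission where

-- Columns 1, …, m of B_m − λI carry ones on the superdiagonal and on the antidiagonal
-- i + j = m + 1, and d = −λ on the diagonal; only column 0 (u = 1 − λ in the corner, v = 1 in the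
-- last row) breaks this pattern.  Call such matrices bordered.  Reordering the indices as
-- 0, m, 1, …, m − 1 peels off the outer layer: expanding along rows 0 and m gives
--   det = u (d c_{m−2} − a_{m−2}) + v a_{m−2},
-- where c_k and a_k are the determinants of the bordered matrices of size k + 1 whose column 0 is
-- (d, 0, …, 0) and (1, 0, …, 0, 1).  Hence c_{k+2} = d (d c_k − a_k) and a_{k+2} = d c_k, and
-- eliminating c and a gives Q_{n+4} = λ² (Q_{n+2} − Q_n).  By Pascal's rule the polynomials
-- G_N = Σ_b (−1)^b C(N−b, b) λ^{2(N−b)} satisfy the same recurrence, so within each parity Q_n is
-- the combination of two consecutive G_N fixed by two initial values.  The sums of the statement,
-- after dropping their vanishing terms (C(N−b, b) = 0 for 2b > N), are exactly these combinations.

open import Defs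
open import Data.Bool using (Bool; true; false; _∨_; _∧_)
import Data.Bool.Properties as Boolₚ
open import Data.Empty using (⊥-elim)
open import Data.Fin using (Fin; toℕ) renaming (zero to fzero; suc to fsuc; punchIn to punchInFin)
open import Data.Integer as ℤ using (ℤ; +_; _-_; _*_; _+_; -_; _^_)
import Data.Integer.Properties as ℤₚ
open import Algebra.Properties.CommutativeSemigroup ℤₚ.+-commutativeSemigroup
  using () renaming (x∙yz≈y∙xz to +-left-comm)
open import Data.Integer.Tactic.RingSolver using (solve-∀)
open import Data.Nat as ℕ using (ℕ; suc; zero; _≤_; _<_; z≤n; s≤s; _∸_; _%_; _/_)
open import Data.Nat.Combinatorics using (_C_; k>n⇒nCk≡0; nCk+nC[k+1]≡[n+1]C[k+1])
open import Data.Nat.DivMod using (m≡m%n+[m/n]*n; m*n/n≡m; /-monoˡ-≤; m<n*o⇒m/o<n)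
import Data.Nat.Properties as ℕₚ
import Data.Nat.Tactic.RingSolver as ℕ-Ring
open import Data.Product using (_×_; ∃; _,_; proj₁)
open import Data.Sum using (_⊎_; inj₁; inj₂)
open import Relation.Binary.Definitions using (tri<; tri≈; tri>)
open import Relation.Binary.PropositionalEquality
open import Relation.Nullary using (¬_; yes; no)
open import Relation.Nullary.Decidable using (dec-true; dec-false)

∑ : ℕ → (ℕ → ℤ) → ℤ
∑ zero    f = + 0
∑ (suc m) f = f 0 + ∑ m (λ i → f (suc i))

∑-cong : ∀ m {f g : ℕ → ℤ} → (∀ i → i < m → f i ≡ g i) → ∑ m f ≡ ∑ m g
∑-cong zero    f≡g = refl
∑-cong (suc m) f≡g =
  cong₂ _+_ (f≡g 0 (s≤s z≤n)) (∑-cong m (λ i i<m → f≡g (suc i) (s≤s i<m)))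

∑-vanishing : ∀ m {f : ℕ → ℤ} → (∀ i → i < m → f i ≡ + 0) → ∑ m f ≡ + 0
∑-vanishing m {f} f≡0 = trans (∑-cong m f≡0) (zeros m)
  where
  zeros : ∀ m → ∑ m (λ _ → + 0) ≡ + 0
  zeros zero    = refl
  zeros (suc m) = trans (ℤₚ.+-identityˡ _) (zeros m)

∑-+ : ∀ m (f g : ℕ → ℤ) → ∑ m (λ i → f i + g i) ≡ ∑ m f + ∑ m g
∑-+ zero    f g = refl
∑-+ (suc m) f g = trans (cong (_+_ (f 0 + g 0)) (∑-+ m _ _)) (interchange (f 0) (g 0) _ _)
  where
  interchange : ∀ a b c d → a + b + (c + d) ≡ a + c + (b + d)
  interchange = solve-∀

∑-neg : ∀ m (f : ℕ → ℤ) → ∑ m (λ i → - f i) ≡ - ∑ m f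
∑-neg zero    f = refl
∑-neg (suc m) f =
  trans (cong (_+_ (- f 0)) (∑-neg m _)) (sym (ℤₚ.neg-distrib-+ (f 0) _))

∑-*ˡ : ∀ m c (f : ℕ → ℤ) → ∑ m (λ i → c * f i) ≡ c * ∑ m f
∑-*ˡ zero    c f = sym (ℤₚ.*-zeroʳ c)
∑-*ˡ (suc m) c f =
  trans (cong (_+_ (c * f 0)) (∑-*ˡ m c _)) (sym (ℤₚ.*-distribˡ-+ c (f 0) _))

∑-comm : ∀ m k (F : ℕ → ℕ → ℤ) →
  ∑ m (λ i → ∑ k (λ j → F i j)) ≡ ∑ k (λ j → ∑ m (λ i → F i j))
∑-comm zero    k F = sym (∑-vanishing k (λ _ _ → refl))
∑-comm (suc m) k F = begin
    ∑ k (F 0) + ∑ m (λ i → ∑ k (F (suc i)))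
  ≡⟨ cong (_+_ (∑ k (F 0))) (∑-comm m k (λ i → F (suc i))) ⟩
    ∑ k (F 0) + ∑ k (λ j → ∑ m (λ i → F (suc i) j))
  ≡⟨ sym (∑-+ k (F 0) _) ⟩
    ∑ k (λ j → F 0 j + ∑ m (λ i → F (suc i) j))
  ∎ where open ≡-Reasoning

∑-last : ∀ m (f : ℕ → ℤ) → ∑ (suc m) f ≡ ∑ m f + f m
∑-last zero    f = ℤₚ.+-comm (f 0) (+ 0)
∑-last (suc m) f =
  trans (cong (_+_ (f 0)) (∑-last m (λ i → f (suc i)))) (sym (ℤₚ.+-assoc (f 0) _ _))

∑-truncate : ∀ {L} K (f : ℕ → ℤ) → L ≤ K → (∀ i → L ≤ i → i < K → f i ≡ + 0) →
  ∑ K f ≡ ∑ L f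
∑-truncate zero    f z≤n     _    = refl
∑-truncate {L} (suc K) f L≤1+K f≡0 with ℕₚ.m≤n⇒m<n∨m≡n L≤1+K
... | inj₂ refl      = refl
... | inj₁ (s≤s L≤K) = begin
    ∑ (suc K) f               ≡⟨ ∑-last K f ⟩
    ∑ K f + f K               ≡⟨ cong₂ _+_ (∑-truncate K f L≤K λ i L≤i i<K → f≡0 i L≤i (ℕₚ.m<n⇒m<1+n i<K))
                                           (f≡0 K L≤K ℕₚ.≤-refl) ⟩
    ∑ L f + + 0               ≡⟨ ℤₚ.+-identityʳ _ ⟩
    ∑ L f                     ∎ where open ≡-Reasoning

punchInℕ : ℕ → ℕ → ℕ
punchInℕ zero    k       = suc k
punchInℕ (suc j) zero    = zero
punchInℕ (suc j) (suc k) = suc (punchInℕ j k)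

punchOutℕ : ℕ → ℕ → ℕ
punchOutℕ zero    zero    = zero
punchOutℕ zero    (suc b) = b
punchOutℕ (suc j) zero    = zero
punchOutℕ (suc j) (suc b) = suc (punchOutℕ j b)

swapAdj : ℕ → ℕ → ℕ
swapAdj zero    zero          = 1
swapAdj zero    (suc zero)    = 0
swapAdj zero    (suc (suc k)) = suc (suc k)
swapAdj (suc a) zero          = zero
swapAdj (suc a) (suc k)       = suc (swapAdj a k)

∑-punchIn : ∀ m j (g : ℕ → ℤ) → j ≤ m → ∑ (suc m) g ≡ g j + ∑ m (λ l → g (punchInℕ j l))
∑-punchIn m       zero    g _         = refl
∑-punchIn (suc m) (suc j) g (s≤s j≤m) = begin
    g 0 + ∑ (suc m) (λ i → g (suc i))
  ≡⟨ cong (_+_ (g 0)) (∑-punchIn m j (λ i → g (suc i)) j≤m) ⟩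
    g 0 + (g (suc j) + ∑ m (λ l → g (suc (punchInℕ j l))))
  ≡⟨ +-left-comm (g 0) (g (suc j)) _ ⟩
    g (suc j) + (g 0 + ∑ m (λ l → g (suc (punchInℕ j l))))
  ∎ where open ≡-Reasoning

∑-swapAdj : ∀ m a (g : ℕ → ℤ) → suc a < m → ∑ m (λ i → g (swapAdj a i)) ≡ ∑ m g
∑-swapAdj (suc (suc m)) zero    g _           = +-left-comm (g 1) (g 0) _
∑-swapAdj (suc m)       (suc a) g (s≤s 1+a<m) = cong (_+_ (g 0)) (∑-swapAdj m a (λ i → g (suc i)) 1+a<m)

-- Determinants of ℕ-indexed matrices

Matrixℕ : Set
Matrixℕ = ℕ → ℕ → ℤ

minor : ℕ → Matrixℕ → Matrixℕ
minor j M i k = M (suc i) (punchInℕ j k)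

detℕ : ℕ → Matrixℕ → ℤ
laplaceTerm : ℕ → Matrixℕ → ℕ → ℤ

detℕ zero    M = + 1
detℕ (suc n) M = ∑ (suc n) (laplaceTerm n M)

laplaceTerm n M j = sgn j * (M 0 j * detℕ n (minor j M))

sumFin≡∑ : ∀ m (f : Fin m → ℤ) (g : ℕ → ℤ) → (∀ i → f i ≡ g (toℕ i)) → sumFin m f ≡ ∑ m g
sumFin≡∑ zero    f g f≡g = refl
sumFin≡∑ (suc m) f g f≡g =
  cong₂ _+_ (f≡g fzero) (sumFin≡∑ m (λ i → f (fsuc i)) (λ i → g (suc i)) (λ i → f≡g (fsuc i)))

toℕ-punchIn : ∀ {n} (j : Fin (suc n)) (k : Fin n) → toℕ (punchInFin j k) ≡ punchInℕ (toℕ j) (toℕ k)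
toℕ-punchIn fzero    k        = refl
toℕ-punchIn (fsuc j) fzero    = refl
toℕ-punchIn (fsuc j) (fsuc k) = cong suc (toℕ-punchIn j k)

det≡detℕ : ∀ n (M : Matrix n) (N : Matrixℕ) → (∀ i k → M i k ≡ N (toℕ i) (toℕ k)) → det n M ≡ detℕ n N
det≡detℕ zero    M N M≡N = refl
det≡detℕ (suc n) M N M≡N = sumFin≡∑ (suc n) _ (laplaceTerm n N) λ j →
  cong (sgn (toℕ j) *_) (cong₂ _*_ (M≡N fzero j) (det≡detℕ n _ (minor (toℕ j) N) λ i k →
    trans (M≡N (fsuc i) (punchInFin j k)) (cong (N (suc (toℕ i))) (toℕ-punchIn j k))))

punchInℕ-< : ∀ j {k n} → k < n → punchInℕ j k < suc n
punchInℕ-< zero    k<n             = s≤s k<n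
punchInℕ-< (suc j) {zero}  _       = s≤s z≤n
punchInℕ-< (suc j) {suc k} (s≤s k<n) = s≤s (punchInℕ-< j k<n)

detℕ-cong : ∀ n {M N : Matrixℕ} → (∀ i k → i < n → k < n → M i k ≡ N i k) → detℕ n M ≡ detℕ n N
detℕ-cong zero    M≡N = refl
detℕ-cong (suc n) M≡N = ∑-cong (suc n) λ j j<1+n →
  cong (sgn j *_) (cong₂ _*_ (M≡N 0 j (s≤s z≤n) j<1+n)
    (detℕ-cong n λ i k i<n k<n → M≡N (suc i) (punchInℕ j k) (s≤s i<n) (punchInℕ-< j k<n)))

detℕ-ext : ∀ n {M N : Matrixℕ} → (∀ i k → M i k ≡ N i k) → detℕ n M ≡ detℕ n N
detℕ-ext n M≡N = detℕ-cong n (λ i k _ _ → M≡N i k)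

detℕ-zero-column₀ : ∀ n (M : Matrixℕ) → (∀ i → i < suc n → M i 0 ≡ + 0) → detℕ (suc n) M ≡ + 0
laplaceTerm-zero-column₀ : ∀ n (M : Matrixℕ) → (∀ i → i < suc n → M i 0 ≡ + 0) →
  ∀ j → j < suc n → laplaceTerm n M j ≡ + 0

detℕ-zero-column₀ n M col≡0 = ∑-vanishing (suc n) (laplaceTerm-zero-column₀ n M col≡0)

laplaceTerm-zero-column₀ n M col≡0 zero _ = begin
  sgn 0 * (M 0 0 * detℕ n (minor 0 M)) ≡⟨ cong (λ z → sgn 0 * (z * detℕ n (minor 0 M))) (col≡0 0 (s≤s z≤n)) ⟩
  sgn 0 * (+ 0 * detℕ n (minor 0 M))   ≡⟨ ℤₚ.*-zeroʳ (sgn 0) ⟩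
  + 0                                   ∎ where open ≡-Reasoning
laplaceTerm-zero-column₀ (suc n) M col≡0 (suc j) (s≤s j<1+n) = begin
  sgn (suc j) * (M 0 (suc j) * detℕ (suc n) (minor (suc j) M))
    ≡⟨ cong (λ z → sgn (suc j) * (M 0 (suc j) * z))
            (detℕ-zero-column₀ n (minor (suc j) M) (λ i i<1+n → col≡0 (suc i) (s≤s i<1+n))) ⟩
  sgn (suc j) * (M 0 (suc j) * + 0)
    ≡⟨ cong (sgn (suc j) *_) (ℤₚ.*-zeroʳ (M 0 (suc j))) ⟩
  sgn (suc j) * + 0
    ≡⟨ ℤₚ.*-zeroʳ (sgn (suc j)) ⟩
  + 0 ∎ where open ≡-Reasoning

detℕ-row₀-support : ∀ r n (M : Matrixℕ) → r ≤ suc n → (∀ q → r ℕ.+ q < suc n → M 0 (r ℕ.+ q) ≡ + 0) →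
  detℕ (suc n) M ≡ ∑ r (laplaceTerm n M)
detℕ-row₀-support r n M r≤1+n row≡0 = ∑-truncate (suc n) (laplaceTerm n M) r≤1+n λ j r≤j j<1+n →
  let j≡r+q = sym (ℕₚ.m+[n∸m]≡n r≤j) in
  trans (cong (λ z → sgn j * (z * detℕ n (minor j M)))
              (trans (cong (M 0) j≡r+q) (row≡0 (j ∸ r) (subst (_< suc n) j≡r+q j<1+n))))
        (trans (cong (sgn j *_) (ℤₚ.*-zeroˡ (detℕ n (minor j M)))) (ℤₚ.*-zeroʳ (sgn j)))

-- Alternation under adjacent transpositions

swapAdj-self : ∀ a → swapAdj a a ≡ suc a
swapAdj-self zero    = refl
swapAdj-self (suc a) = cong suc (swapAdj-self a)

swapAdj-suc : ∀ a → swapAdj a (suc a) ≡ a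
swapAdj-suc zero    = refl
swapAdj-suc (suc a) = cong suc (swapAdj-suc a)

swapAdj-below : ∀ {j a} → j < a → swapAdj a j ≡ j
swapAdj-below {zero}  {suc a} _         = refl
swapAdj-below {suc j} {suc a} (s≤s j<a) = cong suc (swapAdj-below j<a)

swapAdj-above : ∀ {j a} → suc a < j → swapAdj a j ≡ j
swapAdj-above {suc (suc j)} {zero}  _           = refl
swapAdj-above {suc j}       {suc a} (s≤s 1+a<j) = cong suc (swapAdj-above 1+a<j)

swapAdj-punchIn-self : ∀ a k → swapAdj a (punchInℕ a k) ≡ punchInℕ (suc a) k
swapAdj-punchIn-self zero    zero    = refl
swapAdj-punchIn-self zero    (suc k) = refl
swapAdj-punchIn-self (suc a) zero    = refl
swapAdj-punchIn-self (suc a) (suc k) = cong suc (swapAdj-punchIn-self a k)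

swapAdj-punchIn-suc : ∀ a k → swapAdj a (punchInℕ (suc a) k) ≡ punchInℕ a k
swapAdj-punchIn-suc zero    zero    = refl
swapAdj-punchIn-suc zero    (suc k) = refl
swapAdj-punchIn-suc (suc a) zero    = refl
swapAdj-punchIn-suc (suc a) (suc k) = cong suc (swapAdj-punchIn-suc a k)

swapAdj-punchIn-below : ∀ {j a} k → j ≤ a → swapAdj (suc a) (punchInℕ j k) ≡ punchInℕ j (swapAdj a k)
swapAdj-punchIn-below {zero}          k       _         = refl
swapAdj-punchIn-below {suc j} {suc a} zero    _         = refl
swapAdj-punchIn-below {suc j} {suc a} (suc k) (s≤s j≤a) = cong suc (swapAdj-punchIn-below k j≤a)

swapAdj-punchIn-above : ∀ {j a} k → suc a < j → swapAdj a (punchInℕ j k) ≡ punchInℕ j (swapAdj a k)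
swapAdj-punchIn-above {suc (suc j)} {zero}  zero                _           = refl
swapAdj-punchIn-above {suc (suc j)} {zero}  (suc zero)          _           = refl
swapAdj-punchIn-above {suc (suc j)} {zero}  (suc (suc k))       _           = refl
swapAdj-punchIn-above {suc zero}    {zero}  _                   (s≤s ())
swapAdj-punchIn-above {suc j}       {suc a} zero                _           = refl
swapAdj-punchIn-above {suc j}       {suc a} (suc k)             (s≤s 1+a<j) = cong suc (swapAdj-punchIn-above k 1+a<j)

private
  neg-inner : ∀ s x d → s * (x * - d) ≡ - (s * (x * d))
  neg-inner = solve-∀

  neg-sign : ∀ s x d → s * (x * d) ≡ - (- s * (x * d))
  neg-sign = solve-∀

  neg-*-neg : ∀ a b → - a * - b ≡ a * b
  neg-*-neg = solve-∀

swapColumns : ℕ → Matrixℕ → Matrixℕ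
swapColumns a M i k = M i (swapAdj a k)

detℕ-swapColumns : ∀ n a (M : Matrixℕ) → suc a < n → detℕ n (swapColumns a M) ≡ - detℕ n M
laplaceTerm-swapColumns : ∀ n a (M : Matrixℕ) → suc a < suc n → ∀ j → j < suc n →
  laplaceTerm n (swapColumns a M) j ≡ - laplaceTerm n M (swapAdj a j)

detℕ-swapColumns (suc n) a M 1+a<1+n = begin
  ∑ (suc n) (laplaceTerm n (swapColumns a M))      ≡⟨ ∑-cong (suc n) (laplaceTerm-swapColumns n a M 1+a<1+n) ⟩
  ∑ (suc n) (λ j → - laplaceTerm n M (swapAdj a j)) ≡⟨ ∑-neg (suc n) (λ j → laplaceTerm n M (swapAdj a j)) ⟩
  - ∑ (suc n) (λ j → laplaceTerm n M (swapAdj a j)) ≡⟨ cong -_ (∑-swapAdj (suc n) a (laplaceTerm n M) 1+a<1+n) ⟩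
  - ∑ (suc n) (laplaceTerm n M)                     ∎ where open ≡-Reasoning

laplaceTerm-swapColumns n a M 1+a<1+n j (s≤s j≤n) with ℕ.<-cmp j a
laplaceTerm-swapColumns n (suc a) M (s≤s 1+a<n) j _ | tri< j<1+a@(s≤s j≤a) _ _ = begin
  sgn j * (M 0 (swapAdj (suc a) j) * detℕ n (minor j (swapColumns (suc a) M)))
    ≡⟨ cong₂ (λ c D → sgn j * (M 0 c * D)) (swapAdj-below j<1+a)
             (detℕ-ext n (λ i k → cong (M (suc i)) (swapAdj-punchIn-below k j≤a))) ⟩
  sgn j * (M 0 j * detℕ n (swapColumns a (minor j M)))
    ≡⟨ cong (λ D → sgn j * (M 0 j * D)) (detℕ-swapColumns n a (minor j M) 1+a<n) ⟩
  sgn j * (M 0 j * - detℕ n (minor j M))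
    ≡⟨ neg-inner (sgn j) (M 0 j) _ ⟩
  - laplaceTerm n M j
    ≡⟨ cong (λ c → - laplaceTerm n M c) (sym (swapAdj-below j<1+a)) ⟩
  - laplaceTerm n M (swapAdj (suc a) j) ∎ where open ≡-Reasoning
... | tri≈ _ refl _ = begin
  sgn j * (M 0 (swapAdj j j) * detℕ n (minor j (swapColumns j M)))
    ≡⟨ cong₂ (λ c D → sgn j * (M 0 c * D)) (swapAdj-self j)
             (detℕ-ext n (λ i k → cong (M (suc i)) (swapAdj-punchIn-self j k))) ⟩
  sgn j * (M 0 (suc j) * detℕ n (minor (suc j) M))
    ≡⟨ neg-sign (sgn j) (M 0 (suc j)) _ ⟩
  - laplaceTerm n M (suc j)
    ≡⟨ cong (λ c → - laplaceTerm n M c) (sym (swapAdj-self j)) ⟩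
  - laplaceTerm n M (swapAdj j j) ∎ where open ≡-Reasoning
... | tri> _ _ a<j with ℕ.<-cmp j (suc a)
...   | tri< j<1+a _ _ = ⊥-elim (ℕₚ.<-irrefl refl (ℕₚ.≤-trans j<1+a a<j))
...   | tri≈ _ refl _ = begin
  sgn (suc a) * (M 0 (swapAdj a (suc a)) * detℕ n (minor (suc a) (swapColumns a M)))
    ≡⟨ cong₂ (λ c D → sgn (suc a) * (M 0 c * D)) (swapAdj-suc a)
             (detℕ-ext n (λ i k → cong (M (suc i)) (swapAdj-punchIn-suc a k))) ⟩
  sgn (suc a) * (M 0 a * detℕ n (minor a M))
    ≡⟨ sym (ℤₚ.neg-distribˡ-* (sgn a) _) ⟩
  - laplaceTerm n M a
    ≡⟨ cong (λ c → - laplaceTerm n M c) (sym (swapAdj-suc a)) ⟩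
  - laplaceTerm n M (swapAdj a (suc a)) ∎ where open ≡-Reasoning
...   | tri> _ _ 1+a<j = begin
  sgn j * (M 0 (swapAdj a j) * detℕ n (minor j (swapColumns a M)))
    ≡⟨ cong₂ (λ c D → sgn j * (M 0 c * D)) (swapAdj-above 1+a<j)
             (detℕ-ext n (λ i k → cong (M (suc i)) (swapAdj-punchIn-above k 1+a<j))) ⟩
  sgn j * (M 0 j * detℕ n (swapColumns a (minor j M)))
    ≡⟨ cong (λ D → sgn j * (M 0 j * D)) (detℕ-swapColumns n a (minor j M) (ℕₚ.<-≤-trans 1+a<j j≤n)) ⟩
  sgn j * (M 0 j * - detℕ n (minor j M))
    ≡⟨ neg-inner (sgn j) (M 0 j) _ ⟩
  - laplaceTerm n M j
    ≡⟨ cong (λ c → - laplaceTerm n M c) (sym (swapAdj-above 1+a<j)) ⟩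
  - laplaceTerm n M (swapAdj a j) ∎ where open ≡-Reasoning

punchOutℕ-punchInℕ : ∀ j l → punchOutℕ j (punchInℕ j l) ≡ l
punchOutℕ-punchInℕ zero    l       = refl
punchOutℕ-punchInℕ (suc j) zero    = refl
punchOutℕ-punchInℕ (suc j) (suc l) = cong suc (punchOutℕ-punchInℕ j l)

punchInℕᵢ≢i : ∀ j l → ¬ (punchInℕ j l ≡ j)
punchInℕᵢ≢i zero    l       ()
punchInℕᵢ≢i (suc j) zero    ()
punchInℕᵢ≢i (suc j) (suc l) eq = punchInℕᵢ≢i j l (ℕₚ.suc-injective eq)

punchInℕ-punchOutℕ-comm : ∀ j b k → ¬ (j ≡ b) →
  punchInℕ j (punchInℕ (punchOutℕ j b) k) ≡ punchInℕ b (punchInℕ (punchOutℕ b j) k)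
punchInℕ-punchOutℕ-comm zero    zero    k       j≢b = ⊥-elim (j≢b refl)
punchInℕ-punchOutℕ-comm zero    (suc b) k       j≢b = refl
punchInℕ-punchOutℕ-comm (suc j) zero    k       j≢b = refl
punchInℕ-punchOutℕ-comm (suc j) (suc b) zero    j≢b = refl
punchInℕ-punchOutℕ-comm (suc j) (suc b) (suc k) j≢b =
  cong suc (punchInℕ-punchOutℕ-comm j b k (λ j≡b → j≢b (cong suc j≡b)))

sgn-punchOutℕ : ∀ j b → ¬ (j ≡ b) → sgn j * sgn (punchOutℕ j b) ≡ - (sgn b * sgn (punchOutℕ b j))
sgn-punchOutℕ zero    zero    j≢b = ⊥-elim (j≢b refl)
sgn-punchOutℕ zero    (suc b) j≢b = ring (sgn b)
  where
  ring : ∀ s → + 1 * s ≡ - (- s * + 1)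
  ring = solve-∀
sgn-punchOutℕ (suc j) zero    j≢b = ring (sgn j)
  where
  ring : ∀ s → - s * + 1 ≡ - (+ 1 * s)
  ring = solve-∀
sgn-punchOutℕ (suc j) (suc b) j≢b = begin
  - sgn j * - sgn (punchOutℕ j b)     ≡⟨ neg-*-neg (sgn j) _ ⟩
  sgn j * sgn (punchOutℕ j b)         ≡⟨ sgn-punchOutℕ j b (λ j≡b → j≢b (cong suc j≡b)) ⟩
  - (sgn b * sgn (punchOutℕ b j))     ≡⟨ cong -_ (sym (neg-*-neg (sgn b) _)) ⟩
  - (- sgn b * - sgn (punchOutℕ b j)) ∎ where open ≡-Reasoning

-- The coefficient of u j · v b when a determinant with first rows u, v is expanded along both,
-- E j l being the minor left after removing column j and then column l.
pairCofactor : (ℕ → ℕ → ℤ) → ℕ → ℕ → ℤ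
pairCofactor E j b with j ℕ.≟ b
... | yes _ = + 0
... | no  _ = sgn j * (sgn (punchOutℕ j b) * E j (punchOutℕ j b))

pairCofactor-diag : ∀ E j → pairCofactor E j j ≡ + 0
pairCofactor-diag E j with j ℕ.≟ j
... | yes _   = refl
... | no  j≢j = ⊥-elim (j≢j refl)

pairCofactor-punchInℕ : ∀ E j l → pairCofactor E j (punchInℕ j l) ≡ sgn j * (sgn l * E j l)
pairCofactor-punchInℕ E j l with j ℕ.≟ punchInℕ j l
... | yes j≡ = ⊥-elim (punchInℕᵢ≢i j l (sym j≡))
... | no  _  = cong (λ c → sgn j * (sgn c * E j c)) (punchOutℕ-punchInℕ j l)

SymmetricInPair : (ℕ → ℕ → ℤ) → Set
SymmetricInPair E = ∀ j b → ¬ (j ≡ b) → E j (punchOutℕ j b) ≡ E b (punchOutℕ b j)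

pairCofactor-antisym : ∀ E → SymmetricInPair E → ∀ j b → pairCofactor E j b ≡ - pairCofactor E b j
pairCofactor-antisym E symE j b with j ℕ.≟ b | b ℕ.≟ j
... | yes _   | yes _   = refl
... | yes j≡b | no  b≢j = ⊥-elim (b≢j (sym j≡b))
... | no  j≢b | yes b≡j = ⊥-elim (j≢b (sym b≡j))
... | no  j≢b | no  _   = begin
  sgn j * (sgn (punchOutℕ j b) * E j (punchOutℕ j b))
    ≡⟨ cong (λ e → sgn j * (sgn (punchOutℕ j b) * e)) (symE j b j≢b) ⟩
  sgn j * (sgn (punchOutℕ j b) * E b (punchOutℕ b j))
    ≡⟨ sym (ℤₚ.*-assoc (sgn j) _ _) ⟩
  sgn j * sgn (punchOutℕ j b) * E b (punchOutℕ b j)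
    ≡⟨ cong (_* E b (punchOutℕ b j)) (sgn-punchOutℕ j b j≢b) ⟩
  - (sgn b * sgn (punchOutℕ b j)) * E b (punchOutℕ b j)
    ≡⟨ sym (ℤₚ.neg-distribˡ-* (sgn b * sgn (punchOutℕ b j)) _) ⟩
  - (sgn b * sgn (punchOutℕ b j) * E b (punchOutℕ b j))
    ≡⟨ cong -_ (ℤₚ.*-assoc (sgn b) _ _) ⟩
  - (sgn b * (sgn (punchOutℕ b j) * E b (punchOutℕ b j))) ∎ where open ≡-Reasoning

twoRowExpansion : ℕ → (ℕ → ℕ → ℤ) → (ℕ → ℤ) → (ℕ → ℤ) → ℤ
twoRowExpansion n E u v =
  ∑ (suc (suc n)) (λ j → sgn j * (u j * ∑ (suc n) (λ l → sgn l * (v (punchInℕ j l) * E j l))))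

pairSum : ℕ → (ℕ → ℕ → ℤ) → (ℕ → ℤ) → (ℕ → ℤ) → ℤ
pairSum n E u v = ∑ (suc (suc n)) (λ j → ∑ (suc (suc n)) (λ b → u j * (v b * pairCofactor E j b)))

twoRowExpansion≡pairSum : ∀ n E u v → twoRowExpansion n E u v ≡ pairSum n E u v
twoRowExpansion≡pairSum n E u v = ∑-cong (suc (suc n)) λ j j<2+n → begin
  sgn j * (u j * ∑ (suc n) (λ l → sgn l * (v (punchInℕ j l) * E j l)))
    ≡⟨ cong (sgn j *_) (sym (∑-*ˡ (suc n) (u j) (λ l → sgn l * (v (punchInℕ j l) * E j l)))) ⟩
  sgn j * ∑ (suc n) (λ l → u j * (sgn l * (v (punchInℕ j l) * E j l)))
    ≡⟨ sym (∑-*ˡ (suc n) (sgn j) (λ l → u j * (sgn l * (v (punchInℕ j l) * E j l)))) ⟩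
  ∑ (suc n) (λ l → sgn j * (u j * (sgn l * (v (punchInℕ j l) * E j l))))
    ≡⟨ ∑-cong (suc n) (λ l _ → trans (regroup (sgn j) (u j) (sgn l) (v (punchInℕ j l)) (E j l))
         (cong (λ c → u j * (v (punchInℕ j l) * c)) (sym (pairCofactor-punchInℕ E j l)))) ⟩
  ∑ (suc n) (λ l → u j * (v (punchInℕ j l) * pairCofactor E j (punchInℕ j l)))
    ≡⟨ sym (ℤₚ.+-identityˡ _) ⟩
  + 0 + ∑ (suc n) (λ l → u j * (v (punchInℕ j l) * pairCofactor E j (punchInℕ j l)))
    ≡⟨ cong (_+ ∑ (suc n) (λ l → u j * (v (punchInℕ j l) * pairCofactor E j (punchInℕ j l))))
            (sym (diagonal≡0 (u j) (v j) (pairCofactor-diag E j))) ⟩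
  u j * (v j * pairCofactor E j j) + ∑ (suc n) (λ l → u j * (v (punchInℕ j l) * pairCofactor E j (punchInℕ j l)))
    ≡⟨ sym (∑-punchIn (suc n) j (λ b → u j * (v b * pairCofactor E j b)) (ℕₚ.≤-pred j<2+n)) ⟩
  ∑ (suc (suc n)) (λ b → u j * (v b * pairCofactor E j b)) ∎
  where
  open ≡-Reasoning
  regroup : ∀ s x t y e → s * (x * (t * (y * e))) ≡ x * (y * (s * (t * e)))
  regroup = solve-∀
  diagonal≡0 : ∀ x y {c} → c ≡ + 0 → x * (y * c) ≡ + 0
  diagonal≡0 x y refl = trans (cong (x *_) (ℤₚ.*-zeroʳ y)) (ℤₚ.*-zeroʳ x)

twoRowExpansion-antisym : ∀ n E → SymmetricInPair E → ∀ u v →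
  twoRowExpansion n E v u ≡ - twoRowExpansion n E u v
twoRowExpansion-antisym n E symE u v = begin
  twoRowExpansion n E v u
    ≡⟨ twoRowExpansion≡pairSum n E v u ⟩
  ∑ N (λ j → ∑ N (λ b → v j * (u b * pairCofactor E j b)))
    ≡⟨ ∑-comm N N (λ j b → v j * (u b * pairCofactor E j b)) ⟩
  ∑ N (λ b → ∑ N (λ j → v j * (u b * pairCofactor E j b)))
    ≡⟨ ∑-cong N (λ b _ → ∑-cong N (λ j _ →
         trans (cong (λ c → v j * (u b * c)) (pairCofactor-antisym E symE j b))
               (swap-neg (v j) (u b) (pairCofactor E b j)))) ⟩
  ∑ N (λ b → ∑ N (λ j → - (u b * (v j * pairCofactor E b j))))
    ≡⟨ ∑-cong N (λ b _ → ∑-neg N (λ j → u b * (v j * pairCofactor E b j))) ⟩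
  ∑ N (λ b → - ∑ N (λ j → u b * (v j * pairCofactor E b j)))
    ≡⟨ ∑-neg N (λ b → ∑ N (λ j → u b * (v j * pairCofactor E b j))) ⟩
  - pairSum n E u v
    ≡⟨ cong -_ (sym (twoRowExpansion≡pairSum n E u v)) ⟩
  - twoRowExpansion n E u v ∎
  where
  open ≡-Reasoning
  N = suc (suc n)
  swap-neg : ∀ x y c → x * (y * - c) ≡ - (y * (x * c))
  swap-neg = solve-∀

swapRows : ℕ → Matrixℕ → Matrixℕ
swapRows a M i k = M (swapAdj a i) k

detℕ-swapRows : ∀ a n (M : Matrixℕ) → suc a < n → detℕ n (swapRows a M) ≡ - detℕ n M
detℕ-swapRows zero    (suc (suc n)) M _ = twoRowExpansion-antisym n E symE (M 0) (M 1)
  where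
  E : ℕ → ℕ → ℤ
  E j l = detℕ n (minor l (minor j M))
  symE : SymmetricInPair E
  symE j b j≢b = detℕ-ext n (λ i k → cong (M (suc (suc i))) (punchInℕ-punchOutℕ-comm j b k j≢b))
detℕ-swapRows zero    (suc zero)    M (s≤s ())
detℕ-swapRows (suc a) (suc n) M (s≤s 1+a<n) = begin
  ∑ (suc n) (laplaceTerm n (swapRows (suc a) M))
    ≡⟨ ∑-cong (suc n) (λ j _ →
         trans (cong (λ D → sgn j * (M 0 j * D)) (detℕ-swapRows a n (minor j M) 1+a<n))
               (neg-inner (sgn j) (M 0 j) _)) ⟩
  ∑ (suc n) (λ j → - laplaceTerm n M j)
    ≡⟨ ∑-neg (suc n) (laplaceTerm n M) ⟩
  - detℕ (suc n) M ∎ where open ≡-Reasoning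

detℕ-conj-swapAdj : ∀ n a (M : Matrixℕ) → suc a < n → detℕ n (λ i k → M (swapAdj a i) (swapAdj a k)) ≡ detℕ n M
detℕ-conj-swapAdj n a M 1+a<n = begin
  detℕ n (swapRows a (swapColumns a M)) ≡⟨ detℕ-swapRows a n (swapColumns a M) 1+a<n ⟩
  - detℕ n (swapColumns a M)            ≡⟨ cong -_ (detℕ-swapColumns n a M 1+a<n) ⟩
  - - detℕ n M                          ≡⟨ ℤₚ.neg-involutive _ ⟩
  detℕ n M                              ∎ where open ≡-Reasoning

-- The cycle 0 ↦ 0, 1 ↦ m, i+2 ↦ i+1 on {0, …, m}.
rotate : ℕ → ℕ → ℕ
rotate zero          i = i
rotate (suc zero)    i = i
rotate (suc (suc m)) i = swapAdj (suc m) (rotate (suc m) i)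

detℕ-conj-rotate : ∀ N m (M : Matrixℕ) → m < N → detℕ N (λ i k → M (rotate m i) (rotate m k)) ≡ detℕ N M
detℕ-conj-rotate N zero          M _   = refl
detℕ-conj-rotate N (suc zero)    M _   = refl
detℕ-conj-rotate N (suc (suc m)) M m<N = trans
  (detℕ-conj-rotate N (suc m) (λ i k → M (swapAdj (suc m) i) (swapAdj (suc m) k))
                    (ℕₚ.<-trans (ℕₚ.n<1+n (suc m)) m<N))
  (detℕ-conj-swapAdj N (suc m) M m<N)

rotate-above : ∀ m {i} → m < i → rotate m i ≡ i
rotate-above zero          _   = refl
rotate-above (suc zero)    _   = refl
rotate-above (suc (suc m)) m<i =
  trans (cong (swapAdj (suc m)) (rotate-above (suc m) (ℕₚ.<-trans (ℕₚ.n<1+n (suc m)) m<i))) (swapAdj-above m<i)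

rotate-0 : ∀ m → rotate m 0 ≡ 0
rotate-0 zero          = refl
rotate-0 (suc zero)    = refl
rotate-0 (suc (suc m)) = cong (swapAdj (suc m)) (rotate-0 (suc m))

rotate-1 : ∀ m → rotate (suc m) 1 ≡ suc m
rotate-1 zero    = refl
rotate-1 (suc m) = trans (cong (swapAdj (suc m)) (rotate-1 m)) (swapAdj-self (suc m))

rotate-2+ : ∀ m {i} → suc (suc i) ≤ m → rotate m (suc (suc i)) ≡ suc i
rotate-2+-split : ∀ m {i} → (suc i < m) ⊎ (suc i ≡ m) → rotate (suc m) (suc (suc i)) ≡ suc i

rotate-2+ (suc (suc m)) (s≤s 1+i≤1+m) = rotate-2+-split (suc m) (ℕₚ.m≤n⇒m<n∨m≡n 1+i≤1+m)

rotate-2+-split (suc m) (inj₁ 1+i<1+m) =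
  trans (cong (swapAdj (suc m)) (rotate-2+ (suc m) 1+i<1+m)) (swapAdj-below 1+i<1+m)
rotate-2+-split (suc m) (inj₂ refl) =
  trans (cong (swapAdj (suc m)) (rotate-above (suc m) (ℕₚ.n<1+n (suc m)))) (swapAdj-suc (suc m))

-- Bordered matrices

≡ᵇ-refl : ∀ a → (a ℕ.≡ᵇ a) ≡ true
≡ᵇ-refl a = dec-true (a ℕ.≟ a) refl

≢⇒≡ᵇ-false : ∀ {a b} → ¬ (a ≡ b) → (a ℕ.≡ᵇ b) ≡ false
≢⇒≡ᵇ-false {a} {b} = dec-false (a ℕ.≟ b)

0≡ᵇ1+ : ∀ k → (0 ℕ.≡ᵇ suc k) ≡ false
0≡ᵇ1+ k = ≢⇒≡ᵇ-false {0} {suc k} (λ ())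

≡ᵇ-sym : ∀ a b → (a ℕ.≡ᵇ b) ≡ (b ℕ.≡ᵇ a)
≡ᵇ-sym zero    zero    = refl
≡ᵇ-sym zero    (suc b) = refl
≡ᵇ-sym (suc a) zero    = refl
≡ᵇ-sym (suc a) (suc b) = ≡ᵇ-sym a b

-- Columns j ≥ 1 are those of B_m plus d on the diagonal; column 0 is u in the corner, v in row m.
bordered : ℕ → ℤ → ℤ → ℤ → Matrixℕ
bordered m d u v i       (suc j) =
  boolℤ ((suc j ℕ.≡ᵇ suc i) ∨ ((i ℕ.+ suc j) ℕ.≡ᵇ suc m)) + d * boolℤ (i ℕ.≡ᵇ suc j)
bordered m d u v zero    zero    = u
bordered m d u v (suc i) zero    = v * boolℤ (suc i ℕ.≡ᵇ m)

module BorderedEntries (m′ : ℕ) (d u v : ℤ) where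

  m : ℕ
  m = suc (suc m′)

  Z : Matrixℕ
  Z = bordered m d u v

  private
    entry : Bool → Bool → ℤ
    entry b e = boolℤ b + d * boolℤ e

    entry-b0 : ∀ b → entry b false ≡ boolℤ b
    entry-b0 b = trans (cong (_+_ (boolℤ b)) (ℤₚ.*-zeroʳ d)) (ℤₚ.+-identityʳ (boolℤ b))

    entry-ff : entry false false ≡ + 0
    entry-ff = trans (ℤₚ.+-identityˡ (d * + 0)) (ℤₚ.*-zeroʳ d)

    entry-tf : entry true false ≡ + 1
    entry-tf = entry-b0 true

    entry-ft : entry false true ≡ d
    entry-ft = trans (ℤₚ.+-identityˡ (d * + 1)) (ℤₚ.*-identityʳ d)

  row₀-last : Z 0 m ≡ + 0
  row₀-last = trans (cong₂ entry (≢⇒≡ᵇ-false (ℕₚ.<⇒≢ (ℕₚ.n<1+n m′))) (0≡ᵇ1+ (suc m′))) entry-ff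

  row₀-1 : Z 0 1 ≡ + 1
  row₀-1 = trans (cong (entry true) (0≡ᵇ1+ 0)) entry-tf

  row₀-beyond : ∀ {q} → q < m′ → Z 0 (suc (suc q)) ≡ + 0
  row₀-beyond {q} q<m′ = trans
    (cong₂ entry (≢⇒≡ᵇ-false (ℕₚ.<⇒≢ (ℕₚ.m<n⇒m<1+n q<m′))) (0≡ᵇ1+ (suc q))) entry-ff

  last-last : Z m m ≡ d
  last-last = trans
    (cong₂ entry (cong₂ _∨_ (≢⇒≡ᵇ-false (ℕₚ.<⇒≢ (ℕₚ.n<1+n m′)))
                            (≢⇒≡ᵇ-false (ℕₚ.>⇒≢ (ℕₚ.m≤n+m (suc (suc m′)) m′))))
                 (≡ᵇ-refl m′))
    entry-ft

  last-1 : Z m 1 ≡ + 1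
  last-1 = trans
    (cong (λ b → entry b false)
          (cong₂ _∨_ (0≡ᵇ1+ (suc m′)) (trans (cong (ℕ._≡ᵇ suc m′) (ℕₚ.+-comm m′ 1)) (≡ᵇ-refl (suc m′)))))
    entry-tf

  last-middle : ∀ {q} → q < m′ → Z m (suc (suc q)) ≡ + 0
  last-middle {q} q<m′ = trans
    (cong₂ entry (cong₂ _∨_ (≢⇒≡ᵇ-false (ℕₚ.<⇒≢ (ℕₚ.m<n⇒m<1+n q<m′))) (≢⇒≡ᵇ-false (ℕₚ.>⇒≢ 1+m′<m′+2+q)))
                 (≢⇒≡ᵇ-false (ℕₚ.>⇒≢ q<m′)))
    entry-ff
    where
    1+m′<m′+2+q : suc m′ < m′ ℕ.+ suc (suc q)
    1+m′<m′+2+q = subst (suc m′ <_) (sym (trans (ℕₚ.+-suc m′ (suc q)) (cong suc (ℕₚ.+-suc m′ q))))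
                        (s≤s (s≤s (ℕₚ.m≤m+n m′ q)))

  last-0 : Z m 0 ≡ v
  last-0 = trans (cong (λ b → v * boolℤ b) (≡ᵇ-refl m′)) (ℤₚ.*-identityʳ v)

  inner-shift : ∀ u′ v′ i k → Z (suc i) (suc (suc k)) ≡ bordered m′ d u′ v′ i (suc k)
  inner-shift u′ v′ i k =
    cong (λ n → entry ((k ℕ.≡ᵇ i) ∨ (n ℕ.≡ᵇ suc (suc m′))) (i ℕ.≡ᵇ suc k)) (ℕₚ.+-suc i (suc k))

  inner-1 : ∀ {i} → i ≤ m′ → Z (suc i) 1 ≡ bordered m′ d d (+ 0) i 0
  inner-1 {i} i≤m′ = trans
    (cong (λ b → entry b (i ℕ.≡ᵇ 0))
          (cong₂ _∨_ (0≡ᵇ1+ i) (≢⇒≡ᵇ-false (ℕₚ.<⇒≢ (subst (_< suc (suc m′)) (ℕₚ.+-comm 1 i) (s≤s (s≤s i≤m′)))))))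
    (diagonal i)
    where
    diagonal : ∀ i → entry false (i ℕ.≡ᵇ 0) ≡ bordered m′ d d (+ 0) i 0
    diagonal zero    = entry-ft
    diagonal (suc i) = trans entry-ff (sym (ℤₚ.*-zeroˡ (boolℤ (suc i ℕ.≡ᵇ m′))))

  inner-last : ∀ {i} → i ≤ m′ → Z (suc i) m ≡ bordered m′ d (+ 1) (+ 1) i 0
  inner-last {zero}  _ = trans (cong₂ (λ b e → entry ((m′ ℕ.≡ᵇ 0) ∨ b) e) (≡ᵇ-refl m′) (0≡ᵇ1+ m′))
                               (trans (cong (λ b → entry b false) (Boolₚ.∨-zeroʳ (m′ ℕ.≡ᵇ 0))) entry-tf)
  inner-last {suc i} i<m′ = begin
    entry ((m′ ℕ.≡ᵇ suc i) ∨ ((i ℕ.+ suc (suc m′)) ℕ.≡ᵇ suc m′)) (i ℕ.≡ᵇ m′)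
      ≡⟨ cong₂ (λ b e → entry ((m′ ℕ.≡ᵇ suc i) ∨ b) e)
               (≢⇒≡ᵇ-false (ℕₚ.>⇒≢ (ℕₚ.m≤n+m (suc (suc m′)) i))) (≢⇒≡ᵇ-false (ℕₚ.<⇒≢ i<m′)) ⟩
    entry ((m′ ℕ.≡ᵇ suc i) ∨ false) false
      ≡⟨ trans (entry-b0 _) (cong boolℤ (trans (Boolₚ.∨-identityʳ _) (≡ᵇ-sym m′ (suc i)))) ⟩
    boolℤ (suc i ℕ.≡ᵇ m′)
      ≡⟨ sym (ℤₚ.*-identityˡ _) ⟩
    + 1 * boolℤ (suc i ℕ.≡ᵇ m′) ∎ where open ≡-Reasoning

  inner-0 : ∀ {i} → i ≤ m′ → Z (suc i) 0 ≡ + 0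
  inner-0 {i} i≤m′ = trans (cong (λ b → v * boolℤ b) (≢⇒≡ᵇ-false (ℕₚ.<⇒≢ (s≤s i≤m′)))) (ℤₚ.*-zeroʳ v)

laplace₂ : ∀ n (X : Matrixℕ) {x₀ D₀ x₁ D₁} →
  X 0 0 ≡ x₀ → detℕ n (minor 0 X) ≡ D₀ → X 0 1 ≡ x₁ → detℕ n (minor 1 X) ≡ D₁ →
  ∑ 2 (laplaceTerm n X) ≡ x₀ * D₀ - x₁ * D₁
laplace₂ n X refl refl refl refl = expand (X 0 0) (detℕ n (minor 0 X)) (X 0 1) (detℕ n (minor 1 X))
  where
  expand : ∀ x₀ D₀ x₁ D₁ → + 1 * (x₀ * D₀) + (- + 1 * (x₁ * D₁) + + 0) ≡ x₀ * D₀ - x₁ * D₁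
  expand = solve-∀

laplace₃ : ∀ n (X : Matrixℕ) {x₀ D₀ x₁ D₁ x₂ D₂} →
  X 0 0 ≡ x₀ → detℕ n (minor 0 X) ≡ D₀ → X 0 1 ≡ x₁ → detℕ n (minor 1 X) ≡ D₁ →
  X 0 2 ≡ x₂ → detℕ n (minor 2 X) ≡ D₂ →
  ∑ 3 (laplaceTerm n X) ≡ x₀ * D₀ - x₁ * D₁ + x₂ * D₂
laplace₃ n X refl refl refl refl refl refl =
  expand (X 0 0) (detℕ n (minor 0 X)) (X 0 1) (detℕ n (minor 1 X)) (X 0 2) (detℕ n (minor 2 X))
  where
  expand : ∀ x₀ D₀ x₁ D₁ x₂ D₂ →
    + 1 * (x₀ * D₀) + (- + 1 * (x₁ * D₁) + (- - + 1 * (x₂ * D₂) + + 0)) ≡ x₀ * D₀ - x₁ * D₁ + x₂ * D₂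
  expand = solve-∀

cornerDet rimDet : ℕ → ℤ → ℤ
cornerDet m d = detℕ (suc m) (bordered m d d (+ 0))
rimDet    m d = detℕ (suc m) (bordered m d (+ 1) (+ 1))

-- Conjugating by the rotation reorders the indices as 0, m, 1, …, m − 1: after that, each
-- row to be expanded has at most three nonzero entries, and the inner minors are again bordered.
detℕ-bordered : ∀ m′ d u v →
  detℕ (3 ℕ.+ m′) (bordered (2 ℕ.+ m′) d u v) ≡ u * (d * cornerDet m′ d - rimDet m′ d) + v * rimDet m′ d
detℕ-bordered m′ d u v = begin
  detℕ (suc m) Z
    ≡⟨ sym (detℕ-conj-rotate (suc m) m Z (ℕₚ.n<1+n m)) ⟩
  detℕ (suc m) W
    ≡⟨ detℕ-row₀-support 3 (suc (suc m′)) W (s≤s (s≤s (s≤s z≤n))) row₀≡0 ⟩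
  ∑ 3 (laplaceTerm (suc (suc m′)) W)
    ≡⟨ laplace₃ (suc (suc m′)) W (W≡ rot₀ rot₀) det-minor₀ (trans (W≡ rot₀ rot₁) row₀-last) refl
                                 (trans (W≡ rot₀ (rot₂₊ (s≤s z≤n))) row₀-1) det-minor₂ ⟩
  u * (d * c - a) - + 0 * detℕ (suc (suc m′)) (minor 1 W) + + 1 * (v * a - d * + 0)
    ≡⟨ simplify u (d * c - a) v a d (detℕ (suc (suc m′)) (minor 1 W)) ⟩
  u * (d * c - a) + v * a ∎
  where
  open ≡-Reasoning
  open BorderedEntries m′ d u v
  c = cornerDet m′ d
  a = rimDet m′ d

  W : Matrixℕ
  W i k = Z (rotate m i) (rotate m k)

  W≡ : ∀ {i k i′ k′} → rotate m i ≡ i′ → rotate m k ≡ k′ → W i k ≡ Z i′ k′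
  W≡ = cong₂ Z

  rot₀ : rotate m 0 ≡ 0
  rot₀ = rotate-0 m
  rot₁ : rotate m 1 ≡ m
  rot₁ = rotate-1 (suc m′)
  rot₂₊ : ∀ {i} → i < suc m′ → rotate m (suc (suc i)) ≡ suc i
  rot₂₊ i<1+m′ = rotate-2+ m (s≤s i<1+m′)

  row₀≡0 : ∀ q → 3 ℕ.+ q < suc m → W 0 (3 ℕ.+ q) ≡ + 0
  row₀≡0 q (s≤s (s≤s (s≤s q<m′))) = trans (W≡ rot₀ (rot₂₊ (s≤s q<m′))) (row₀-beyond q<m′)

  row₁≡0 : ∀ q → 2 ℕ.+ q < suc (suc m′) → W 1 (3 ℕ.+ q) ≡ + 0
  row₁≡0 q (s≤s (s≤s q<m′)) = trans (W≡ rot₁ (rot₂₊ (s≤s q<m′))) (last-middle q<m′)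

  innerCorner : ∀ i k → i < suc m′ → k < suc m′ → W (suc (suc i)) (suc (suc k)) ≡ bordered m′ d d (+ 0) i k
  innerCorner i zero    i< k< = trans (W≡ (rot₂₊ i<) (rot₂₊ k<)) (inner-1 (ℕₚ.≤-pred i<))
  innerCorner i (suc k) i< k< = trans (W≡ (rot₂₊ i<) (rot₂₊ k<)) (inner-shift d (+ 0) i k)

  innerRim : ∀ i k → i < suc m′ → k < suc m′ → W (suc (suc i)) (suc (punchInℕ 1 k)) ≡ bordered m′ d (+ 1) (+ 1) i k
  innerRim i zero    i< k< = trans (W≡ (rot₂₊ i<) rot₁) (inner-last (ℕₚ.≤-pred i<))
  innerRim i (suc k) i< k< = trans (W≡ (rot₂₊ i<) (rot₂₊ k<)) (inner-shift (+ 1) (+ 1) i k)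

  det-minor₀ : detℕ (suc (suc m′)) (minor 0 W) ≡ d * c - a
  det-minor₀ = begin
    detℕ (suc (suc m′)) (minor 0 W)
      ≡⟨ detℕ-row₀-support 2 (suc m′) (minor 0 W) (s≤s (s≤s z≤n)) row₁≡0 ⟩
    ∑ 2 (laplaceTerm (suc m′) (minor 0 W))
      ≡⟨ laplace₂ (suc m′) (minor 0 W) (trans (W≡ rot₁ rot₁) last-last) (detℕ-cong (suc m′) innerCorner)
                                       (trans (W≡ rot₁ (rot₂₊ (s≤s z≤n))) last-1) (detℕ-cong (suc m′) innerRim) ⟩
    d * c - + 1 * a
      ≡⟨ cong (_-_ (d * c)) (ℤₚ.*-identityˡ a) ⟩
    d * c - a ∎

  det-minor₂ : detℕ (suc (suc m′)) (minor 2 W) ≡ v * a - d * + 0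
  det-minor₂ = begin
    detℕ (suc (suc m′)) (minor 2 W)
      ≡⟨ detℕ-row₀-support 2 (suc m′) (minor 2 W) (s≤s (s≤s z≤n)) row₁≡0 ⟩
    ∑ 2 (laplaceTerm (suc m′) (minor 2 W))
      ≡⟨ laplace₂ (suc m′) (minor 2 W) (trans (W≡ rot₁ rot₀) last-0) (detℕ-cong (suc m′) innerRim)
                                       (trans (W≡ rot₁ rot₁) last-last)
                                       (detℕ-zero-column₀ m′ (minor 1 (minor 2 W))
                                          (λ i i< → trans (W≡ (rot₂₊ i<) rot₀) (inner-0 (ℕₚ.≤-pred i<)))) ⟩
    v * a - d * + 0 ∎

  simplify : ∀ u x v a d e → u * x - + 0 * e + + 1 * (v * a - d * + 0) ≡ u * x + v * a
  simplify = solve-∀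

idM≡ : ∀ n (i k : Fin n) → idM n i k ≡ boolℤ (toℕ i ℕ.≡ᵇ toℕ k)
idM≡ n i k with toℕ i ℕ.≡ᵇ toℕ k
... | true  = refl
... | false = refl

Q≡detℕ-bordered : ∀ n x → Q n x ≡ detℕ (suc n) (bordered n (- x) (+ 1 - x) (+ 1))
Q≡detℕ-bordered n x = begin
  Q n x                              ≡⟨ det≡detℕ (suc n) _ B-λI (λ i k → cong (λ e → B n i k - x * e) (idM≡ (suc n) i k)) ⟩
  detℕ (suc n) B-λI                  ≡⟨ detℕ-cong (suc n) entries ⟩
  detℕ (suc n) (bordered n (- x) (+ 1 - x) (+ 1)) ∎
  where
  open ≡-Reasoning
  B-λI : Matrixℕ
  B-λI i k = boolℤ (bEntry n i k) - x * boolℤ (i ℕ.≡ᵇ k)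

  entries : ∀ i k → i < suc n → k < suc n → B-λI i k ≡ bordered n (- x) (+ 1 - x) (+ 1) i k
  entries zero    zero    _         _ = cong (_-_ (+ 1)) (ℤₚ.*-identityʳ x)
  entries (suc i) zero    (s≤s i<n) _ = begin
    boolℤ (((suc i ℕ.≡ᵇ n) ∧ true) ∨ (0 ℕ.≡ᵇ suc (suc i)) ∨ ((i ℕ.+ 0) ℕ.≡ᵇ n)) - x * + 0
      ≡⟨ cong₂ (λ b e → boolℤ (b ∨ e) - x * + 0)
               (Boolₚ.∧-identityʳ (suc i ℕ.≡ᵇ n))
               (cong₂ _∨_ (0≡ᵇ1+ (suc i)) (≢⇒≡ᵇ-false (ℕₚ.<⇒≢ (subst (_< n) (sym (ℕₚ.+-identityʳ i)) i<n)))) ⟩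
    boolℤ ((suc i ℕ.≡ᵇ n) ∨ false) - x * + 0
      ≡⟨ cong₂ (λ b e → boolℤ b - e) (Boolₚ.∨-identityʳ (suc i ℕ.≡ᵇ n)) (ℤₚ.*-zeroʳ x) ⟩
    boolℤ (suc i ℕ.≡ᵇ n) - + 0
      ≡⟨ trans (ℤₚ.+-identityʳ _) (sym (ℤₚ.*-identityˡ _)) ⟩
    + 1 * boolℤ (suc i ℕ.≡ᵇ n) ∎
  entries i       (suc k) _         _ =
    cong₂ (λ b e → boolℤ b + e)
          (cong₂ (λ a b → a ∨ b ∨ rest) (Boolₚ.∧-zeroʳ (i ℕ.≡ᵇ 0)) (Boolₚ.∧-zeroʳ (i ℕ.≡ᵇ n)))
          (ℤₚ.neg-distribˡ-* x (boolℤ (i ℕ.≡ᵇ suc k)))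
    where
    rest : Bool
    rest = (suc k ℕ.≡ᵇ suc i) ∨ ((i ℕ.+ suc k) ℕ.≡ᵇ suc n)

cornerDet-step : ∀ m d → cornerDet (2 ℕ.+ m) d ≡ d * (d * cornerDet m d - rimDet m d)
cornerDet-step m d = trans (detℕ-bordered m d d (+ 0)) (drop d (d * cornerDet m d - rimDet m d) (rimDet m d))
  where
  drop : ∀ d e a → d * e + + 0 * a ≡ d * e
  drop = solve-∀

rimDet-step : ∀ m d → rimDet (2 ℕ.+ m) d ≡ d * cornerDet m d
rimDet-step m d = trans (detℕ-bordered m d (+ 1) (+ 1)) (cancel (d * cornerDet m d) (rimDet m d))
  where
  cancel : ∀ e a → + 1 * (e - a) + + 1 * a ≡ e
  cancel = solve-∀

Q-step : ∀ m x → Q (2 ℕ.+ m) x ≡ (+ 1 - x) * (- x * cornerDet m (- x) - rimDet m (- x)) + + 1 * rimDet m (- x)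
Q-step m x = trans (Q≡detℕ-bordered (2 ℕ.+ m) x) (detℕ-bordered m (- x) (+ 1 - x) (+ 1))

Q-step-at : ∀ m x {c a} → cornerDet m (- x) ≡ c → rimDet m (- x) ≡ a → Q (2 ℕ.+ m) x ≡ (+ 1 - x) * (- x * c - a) + + 1 * a
Q-step-at m x refl refl = Q-step m x

Q-recurrence : ∀ m x → Q (6 ℕ.+ m) x ≡ x * x * (Q (4 ℕ.+ m) x - Q (2 ℕ.+ m) x)
Q-recurrence m x = begin
  Q (6 ℕ.+ m) x
    ≡⟨ Q-step-at (4 ℕ.+ m) x c₄ a₄ ⟩
  q (d * (d * (d * (d * c - a)) - d * c)) (d * (d * (d * c - a)))
    ≡⟨ identity x c a ⟩
  x * x * (q (d * (d * c - a)) (d * c) - q c a)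
    ≡⟨ sym (cong₂ (λ e e′ → x * x * (e - e′)) (Q-step-at (2 ℕ.+ m) x c₂ a₂) (Q-step m x)) ⟩
  x * x * (Q (4 ℕ.+ m) x - Q (2 ℕ.+ m) x) ∎
  where
  open ≡-Reasoning
  d = - x
  c = cornerDet m d
  a = rimDet m d
  q : ℤ → ℤ → ℤ
  q c′ a′ = (+ 1 - x) * (- x * c′ - a′) + + 1 * a′

  c₂ : cornerDet (2 ℕ.+ m) d ≡ d * (d * c - a)
  c₂ = cornerDet-step m d
  a₂ : rimDet (2 ℕ.+ m) d ≡ d * c
  a₂ = rimDet-step m d
  c₄ : cornerDet (4 ℕ.+ m) d ≡ d * (d * (d * (d * c - a)) - d * c)
  c₄ = trans (cornerDet-step (2 ℕ.+ m) d) (cong₂ (λ c′ a′ → d * (d * c′ - a′)) c₂ a₂)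
  a₄ : rimDet (4 ℕ.+ m) d ≡ d * (d * (d * c - a))
  a₄ = trans (rimDet-step (2 ℕ.+ m) d) (cong (d *_) c₂)

  identity : ∀ x c a →
    (+ 1 - x) * (- x * (- x * (- x * (- x * (- x * c - a)) - - x * c)) - - x * (- x * (- x * c - a)))
      + + 1 * (- x * (- x * (- x * c - a)))
    ≡ x * x * (((+ 1 - x) * (- x * (- x * (- x * c - a)) - - x * c) + + 1 * (- x * c))
               - ((+ 1 - x) * (- x * c - a) + + 1 * a))
  identity = solve-∀

detℕ-1 : ∀ M → detℕ 1 M ≡ M 0 0
detℕ-1 M = unit (M 0 0)
  where
  unit : ∀ a → + 1 * (a * + 1) + + 0 ≡ a
  unit = solve-∀

cornerDet-0 : ∀ d → cornerDet 0 d ≡ d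
cornerDet-0 d = detℕ-1 (bordered 0 d d (+ 0))

rimDet-0 : ∀ d → rimDet 0 d ≡ + 1
rimDet-0 d = refl

cornerDet-1 : ∀ d → cornerDet 1 d ≡ d * (+ 1 + d)
cornerDet-1 d = trans (laplace₂ 1 M refl (detℕ-1 (minor 0 M)) refl (detℕ-1 (minor 1 M))) (expand d)
  where
  M = bordered 1 d d (+ 0)
  expand : ∀ d → d * (+ 1 + d * + 1) - (+ 1 + d * + 0) * (+ 0 * + 1) ≡ d * (+ 1 + d)
  expand = solve-∀

rimDet-1 : ∀ d → rimDet 1 d ≡ d
rimDet-1 d = trans (laplace₂ 1 M refl (detℕ-1 (minor 0 M)) refl (detℕ-1 (minor 1 M))) (expand d)
  where
  M = bordered 1 d (+ 1) (+ 1)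
  expand : ∀ d → + 1 * (+ 1 + d * + 1) - (+ 1 + d * + 0) * (+ 1 * + 1) ≡ d
  expand = solve-∀

cornerDet-2 : ∀ d → cornerDet 2 d ≡ d * (d * d - + 1)
cornerDet-2 d = trans (cornerDet-step 0 d) (cong₂ (λ c a → d * (d * c - a)) (cornerDet-0 d) (rimDet-0 d))

rimDet-2 : ∀ d → rimDet 2 d ≡ d * d
rimDet-2 d = trans (rimDet-step 0 d) (cong (d *_) (cornerDet-0 d))

cornerDet-3 : ∀ d → cornerDet 3 d ≡ d * (d * (d * (+ 1 + d)) - d)
cornerDet-3 d = trans (cornerDet-step 1 d) (cong₂ (λ c a → d * (d * c - a)) (cornerDet-1 d) (rimDet-1 d))

rimDet-3 : ∀ d → rimDet 3 d ≡ d * (d * (+ 1 + d))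
rimDet-3 d = trans (rimDet-step 1 d) (cong (d *_) (cornerDet-1 d))

-- Alternating binomial sums

binomialSum : (ℕ → ℤ) → ℕ → ℤ
binomialSum w N = ∑ (suc N) (λ b → sgn b * + ((N ∸ b) C b) * w (N ∸ b))

binomial-vanishes : ∀ {N b} → N < b ℕ.+ b → (N ∸ b) C b ≡ 0
binomial-vanishes {N} {suc b} N<2b = k>n⇒nCk≡0 (ℕₚ.m<n+o⇒m∸n<o N (suc b) N<2b)

binomialSum-scale : ∀ N c (w w′ : ℕ → ℤ) → (∀ a → w′ a ≡ c * w a) → binomialSum w′ N ≡ c * binomialSum w N
binomialSum-scale N c w w′ w′≡cw = begin
  ∑ (suc N) (λ b → sgn b * + ((N ∸ b) C b) * w′ (N ∸ b))
    ≡⟨ ∑-cong (suc N) (λ b _ → trans (cong (λ e → sgn b * + ((N ∸ b) C b) * e) (w′≡cw (N ∸ b)))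
                                     (pull (sgn b) (+ ((N ∸ b) C b)) c (w (N ∸ b)))) ⟩
  ∑ (suc N) (λ b → c * (sgn b * + ((N ∸ b) C b) * w (N ∸ b)))
    ≡⟨ ∑-*ˡ (suc N) c (λ b → sgn b * + ((N ∸ b) C b) * w (N ∸ b)) ⟩
  c * binomialSum w N ∎
  where
  open ≡-Reasoning
  pull : ∀ s k c e → s * k * (c * e) ≡ c * (s * k * e)
  pull = solve-∀

binomialTerm-vanishes : ∀ N b s e → N < b ℕ.+ b → s * + ((N ∸ b) C b) * e ≡ + 0
binomialTerm-vanishes N b s e N<2b = begin
  s * + ((N ∸ b) C b) * e ≡⟨ cong (λ k → s * + k * e) (binomial-vanishes {N} {b} N<2b) ⟩
  s * + 0 * e             ≡⟨ cong (_* e) (ℤₚ.*-zeroʳ s) ⟩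
  + 0 * e                 ≡⟨ ℤₚ.*-zeroˡ e ⟩
  + 0                     ∎ where open ≡-Reasoning

binomialSum-pascal : ∀ N (w : ℕ → ℤ) →
  binomialSum w (2 ℕ.+ N) ≡ binomialSum (λ a → w (suc a)) (1 ℕ.+ N) - binomialSum (λ a → w (suc a)) N
binomialSum-pascal N w = begin
  t 0 + ∑ (2 ℕ.+ N) (λ b → t (suc b))
    ≡⟨ cong (_+_ (t 0)) (∑-cong (2 ℕ.+ N) pascal) ⟩
  t 0 + ∑ (2 ℕ.+ N) (λ b → u (suc b) - v b)
    ≡⟨ cong (_+_ (t 0)) (trans (∑-+ (2 ℕ.+ N) (λ b → u (suc b)) (λ b → - v b))
                               (cong (_+_ (∑ (2 ℕ.+ N) (λ b → u (suc b)))) (∑-neg (2 ℕ.+ N) v))) ⟩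
  t 0 + (∑ (2 ℕ.+ N) (λ b → u (suc b)) - ∑ (2 ℕ.+ N) v)
    ≡⟨ cong₂ (λ e e′ → t 0 + (e - e′)) (∑-last (1 ℕ.+ N) (λ b → u (suc b))) (∑-last (1 ℕ.+ N) v) ⟩
  t 0 + ((∑ (1 ℕ.+ N) (λ b → u (suc b)) + u (2 ℕ.+ N)) - (∑ (1 ℕ.+ N) v + v (1 ℕ.+ N)))
    ≡⟨ cong₂ (λ e e′ → t 0 + ((∑ (1 ℕ.+ N) (λ b → u (suc b)) + e) - (∑ (1 ℕ.+ N) v + e′)))
             u-top v-top ⟩
  t 0 + ((∑ (1 ℕ.+ N) (λ b → u (suc b)) + + 0) - (∑ (1 ℕ.+ N) v + + 0))
    ≡⟨ regroup (t 0) (∑ (1 ℕ.+ N) (λ b → u (suc b))) (∑ (1 ℕ.+ N) v) ⟩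
  t 0 + ∑ (1 ℕ.+ N) (λ b → u (suc b)) - ∑ (1 ℕ.+ N) v ∎
  where
  open ≡-Reasoning
  t u v : ℕ → ℤ
  t b = sgn b * + ((2 ℕ.+ N ∸ b) C b) * w (2 ℕ.+ N ∸ b)
  u b = sgn b * + ((1 ℕ.+ N ∸ b) C b) * w (suc (1 ℕ.+ N ∸ b))
  v b = sgn b * + ((N ∸ b) C b) * w (suc (N ∸ b))

  t-top : t (2 ℕ.+ N) ≡ + 0
  t-top = binomialTerm-vanishes (2 ℕ.+ N) (2 ℕ.+ N) (sgn (2 ℕ.+ N)) (w (2 ℕ.+ N ∸ (2 ℕ.+ N)))
                                (ℕₚ.m<m+n (2 ℕ.+ N) (s≤s z≤n))
  u-top : u (2 ℕ.+ N) ≡ + 0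
  u-top = binomialTerm-vanishes (1 ℕ.+ N) (2 ℕ.+ N) (sgn (2 ℕ.+ N)) (w (suc (1 ℕ.+ N ∸ (2 ℕ.+ N))))
                                (ℕₚ.m≤n+m _ (2 ℕ.+ N))
  v-top : v (1 ℕ.+ N) ≡ + 0
  v-top = binomialTerm-vanishes N (1 ℕ.+ N) (sgn (1 ℕ.+ N)) (w (suc (N ∸ (1 ℕ.+ N)))) (ℕₚ.m≤n+m _ (1 ℕ.+ N))

  split : ∀ s c c′ e → - s * (c + c′) * e ≡ - s * c′ * e - s * c * e
  split = solve-∀
  regroup : ∀ a b c → a + ((b + + 0) - (c + + 0)) ≡ a + b - c
  regroup = solve-∀

  pascal : ∀ b → b < 2 ℕ.+ N → t (suc b) ≡ u (suc b) - v b
  pascal b (s≤s b≤1+N) with ℕₚ.m≤n⇒m<n∨m≡n b≤1+N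
  ... | inj₁ (s≤s b≤N) = begin
    - sgn b * + ((1 ℕ.+ N ∸ b) C suc b) * w (1 ℕ.+ N ∸ b)
      ≡⟨ cong (λ m → - sgn b * + (m C suc b) * w m) (ℕₚ.+-∸-assoc 1 b≤N) ⟩
    - sgn b * + (suc (N ∸ b) C suc b) * w (suc (N ∸ b))
      ≡⟨ cong (λ k → - sgn b * + k * w (suc (N ∸ b))) (sym (nCk+nC[k+1]≡[n+1]C[k+1] (N ∸ b) b)) ⟩
    - sgn b * (+ ((N ∸ b) C b) + + ((N ∸ b) C suc b)) * w (suc (N ∸ b))
      ≡⟨ split (sgn b) (+ ((N ∸ b) C b)) (+ ((N ∸ b) C suc b)) (w (suc (N ∸ b))) ⟩
    u (suc b) - v b ∎
  ... | inj₂ refl = begin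
    t (suc b)       ≡⟨ t-top ⟩
    + 0             ≡⟨ sym (cong₂ _-_ u-top v-top) ⟩
    u (suc b) - v b ∎

-- Only the terms with 2b ≤ N, i.e. b ≤ N − b, survive: the cut-off L and the values of g at the
-- other terms are irrelevant.
binomialSum-from : ∀ {L} N (w g : ℕ → ℤ) → L ≤ suc N → (∀ b → L ≤ b → N < b ℕ.+ b) →
  (∀ a b → b ≤ a → a ℕ.+ b ≡ N → g b ≡ w a) →
  ∑ L (λ b → sgn b * + ((N ∸ b) C b) * g b) ≡ binomialSum w N
binomialSum-from {L} N w g L≤1+N beyond agree = begin
  ∑ L F
    ≡⟨ sym (∑-truncate (suc N) F L≤1+N (λ b L≤b _ → binomialTerm-vanishes N b (sgn b) (g b) (beyond b L≤b))) ⟩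
  ∑ (suc N) F
    ≡⟨ ∑-cong (suc N) termwise ⟩
  binomialSum w N ∎
  where
  open ≡-Reasoning
  F : ℕ → ℤ
  F b = sgn b * + ((N ∸ b) C b) * g b

  termwise : ∀ b → b < suc N → F b ≡ sgn b * + ((N ∸ b) C b) * w (N ∸ b)
  termwise b (s≤s b≤N) with b ℕ.+ b ℕ.≤? N
  ... | yes 2b≤N = cong (sgn b * + ((N ∸ b) C b) *_)
                        (agree (N ∸ b) b (ℕₚ.m+n≤o⇒m≤o∸n b 2b≤N) (ℕₚ.m∸n+n≡m b≤N))
  ... | no  2b≰N = trans (binomialTerm-vanishes N b (sgn b) (g b) (ℕₚ.≰⇒> 2b≰N))
                        (sym (binomialTerm-vanishes N b (sgn b) (w (N ∸ b)) (ℕₚ.≰⇒> 2b≰N)))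

G : ℤ → ℕ → ℤ
G y = binomialSum (y ^_)

Recurrent : ℤ → (ℕ → ℤ) → Set
Recurrent y s = ∀ k → s (2 ℕ.+ k) ≡ y * (s (1 ℕ.+ k) - s k)

G-recurrent : ∀ y → Recurrent y (G y)
G-recurrent y N = begin
  G y (2 ℕ.+ N)
    ≡⟨ binomialSum-pascal N (y ^_) ⟩
  binomialSum (λ a → y ^ suc a) (1 ℕ.+ N) - binomialSum (λ a → y ^ suc a) N
    ≡⟨ cong₂ _-_ (binomialSum-scale (1 ℕ.+ N) y (y ^_) _ (λ _ → refl)) (binomialSum-scale N y (y ^_) _ (λ _ → refl)) ⟩
  y * G y (1 ℕ.+ N) - y * G y N
    ≡⟨ factor y (G y (1 ℕ.+ N)) (G y N) ⟩
  y * (G y (1 ℕ.+ N) - G y N) ∎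
  where
  open ≡-Reasoning
  factor : ∀ y a b → y * a - y * b ≡ y * (a - b)
  factor = solve-∀

G-1 : ∀ y → G y 1 ≡ y
G-1 y = evaluate y
  where
  evaluate : ∀ y → + 1 * + 1 * (y * + 1) + (- + 1 * + 0 * + 1 + + 0) ≡ y
  evaluate = solve-∀

G-2 : ∀ y → G y 2 ≡ y * (y - + 1)
G-2 y = trans (G-recurrent y 0) (cong (λ g → y * (g - + 1)) (G-1 y))

recurrent-combination : ∀ {y s} → Recurrent y s → ∀ c c′ → Recurrent y (λ k → c * s (suc k) + c′ * s k)
recurrent-combination {y} {s} rec c c′ k = begin
  c * s (3 ℕ.+ k) + c′ * s (2 ℕ.+ k)
    ≡⟨ cong₂ (λ e e′ → c * e + c′ * e′) (rec (suc k)) (rec k) ⟩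
  c * (y * (s (2 ℕ.+ k) - s (1 ℕ.+ k))) + c′ * (y * (s (1 ℕ.+ k) - s k))
    ≡⟨ regroup y c c′ (s (2 ℕ.+ k)) (s (1 ℕ.+ k)) (s k) ⟩
  y * (c * s (2 ℕ.+ k) + c′ * s (1 ℕ.+ k) - (c * s (1 ℕ.+ k) + c′ * s k)) ∎
  where
  open ≡-Reasoning
  regroup : ∀ y c c′ s₂ s₁ s₀ →
    c * (y * (s₂ - s₁)) + c′ * (y * (s₁ - s₀)) ≡ y * (c * s₂ + c′ * s₁ - (c * s₁ + c′ * s₀))
  regroup = solve-∀

recurrent-unique : ∀ {y s t} → Recurrent y s → Recurrent y t → s 0 ≡ t 0 → s 1 ≡ t 1 → ∀ k → s k ≡ t k
recurrent-unique {y} {s} {t} rec-s rec-t s₀≡t₀ s₁≡t₁ k = proj₁ (agree k)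
  where
  agree : ∀ k → s k ≡ t k × s (suc k) ≡ t (suc k)
  agree zero    = s₀≡t₀ , s₁≡t₁
  agree (suc k) with agree k
  ... | sₖ≡tₖ , sₖ₊₁≡tₖ₊₁ =
    sₖ₊₁≡tₖ₊₁ , trans (rec-s k) (trans (cong₂ (λ a b → y * (a - b)) sₖ₊₁≡tₖ₊₁ sₖ≡tₖ) (sym (rec-t k)))

Q-odd : ∀ j x → Q (3 ℕ.+ j ℕ.* 2) x ≡ (x - + 2) * (x * G (x * x) (suc j))
Q-odd j x = begin
  Q (3 ℕ.+ j ℕ.* 2) x
    ≡⟨ recurrent-unique {y} {λ k → Q (3 ℕ.+ k ℕ.* 2) x} {λ k → (x - + 2) * x * G y (suc k) + + 0 * G y k}
         (λ k → Q-recurrence (1 ℕ.+ k ℕ.* 2) x)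
         (recurrent-combination {y} {G y} (G-recurrent y) ((x - + 2) * x) (+ 0)) Q₃ Q₅ j ⟩
  (x - + 2) * x * G y (suc j) + + 0 * G y j
    ≡⟨ tidy x (G y (suc j)) (G y j) ⟩
  (x - + 2) * (x * G y (suc j)) ∎
  where
  open ≡-Reasoning
  y = x * x
  d = - x
  tidy : ∀ x g g′ → (x - + 2) * x * g + + 0 * g′ ≡ (x - + 2) * (x * g)
  tidy = solve-∀

  Q₃ : Q 3 x ≡ (x - + 2) * x * G y 1 + + 0 * G y 0
  Q₃ = begin
    Q 3 x
      ≡⟨ Q-step-at 1 x (cornerDet-1 d) (rimDet-1 d) ⟩
    (+ 1 - x) * (d * (d * (+ 1 + d)) - d) + + 1 * d
      ≡⟨ expand x ⟩
    (x - + 2) * x * y + + 0 * + 1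
      ≡⟨ cong (λ g → (x - + 2) * x * g + + 0 * + 1) (sym (G-1 y)) ⟩
    (x - + 2) * x * G y 1 + + 0 * G y 0 ∎
    where
    expand : ∀ x → (+ 1 - x) * (- x * (- x * (+ 1 + - x)) - - x) + + 1 * - x ≡ (x - + 2) * x * (x * x) + + 0 * + 1
    expand = solve-∀

  Q₅ : Q 5 x ≡ (x - + 2) * x * G y 2 + + 0 * G y 1
  Q₅ = begin
    Q 5 x
      ≡⟨ Q-step-at 3 x (cornerDet-3 d) (rimDet-3 d) ⟩
    (+ 1 - x) * (d * (d * (d * (d * (+ 1 + d)) - d)) - d * (d * (+ 1 + d))) + + 1 * (d * (d * (+ 1 + d)))
      ≡⟨ expand x ⟩
    (x - + 2) * x * (y * (y - + 1)) + + 0 * y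
      ≡⟨ cong₂ (λ g g′ → (x - + 2) * x * g + + 0 * g′) (sym (G-2 y)) (sym (G-1 y)) ⟩
    (x - + 2) * x * G y 2 + + 0 * G y 1 ∎
    where
    expand : ∀ x → (+ 1 - x) * (- x * (- x * (- x * (- x * (+ 1 + - x)) - - x)) - - x * (- x * (+ 1 + - x)))
                     + + 1 * (- x * (- x * (+ 1 + - x)))
                   ≡ (x - + 2) * x * ((x * x) * (x * x - + 1)) + + 0 * (x * x)
    expand = solve-∀

Q-even : ∀ j x → Q (2 ℕ.+ j ℕ.* 2) x ≡ (+ 1 - x) * G (x * x) (suc j) + x * G (x * x) j
Q-even j x =
  recurrent-unique {y} {λ k → Q (2 ℕ.+ k ℕ.* 2) x} {λ k → (+ 1 - x) * G y (suc k) + x * G y k}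
    (λ k → Q-recurrence (k ℕ.* 2) x) (recurrent-combination {y} {G y} (G-recurrent y) (+ 1 - x) x) Q₂ Q₄ j
  where
  open ≡-Reasoning
  y = x * x
  d = - x

  Q₂ : Q 2 x ≡ (+ 1 - x) * G y 1 + x * G y 0
  Q₂ = begin
    Q 2 x
      ≡⟨ Q-step-at 0 x (cornerDet-0 d) (rimDet-0 d) ⟩
    (+ 1 - x) * (d * d - + 1) + + 1 * + 1
      ≡⟨ expand x ⟩
    (+ 1 - x) * y + x * + 1
      ≡⟨ cong (λ g → (+ 1 - x) * g + x * + 1) (sym (G-1 y)) ⟩
    (+ 1 - x) * G y 1 + x * G y 0 ∎
    where
    expand : ∀ x → (+ 1 - x) * (- x * - x - + 1) + + 1 * + 1 ≡ (+ 1 - x) * (x * x) + x * + 1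
    expand = solve-∀

  Q₄ : Q 4 x ≡ (+ 1 - x) * G y 2 + x * G y 1
  Q₄ = begin
    Q 4 x
      ≡⟨ Q-step-at 2 x (cornerDet-2 d) (rimDet-2 d) ⟩
    (+ 1 - x) * (d * (d * (d * d - + 1)) - d * d) + + 1 * (d * d)
      ≡⟨ expand x ⟩
    (+ 1 - x) * (y * (y - + 1)) + x * y
      ≡⟨ cong₂ (λ g g′ → (+ 1 - x) * g + x * g′) (sym (G-2 y)) (sym (G-1 y)) ⟩
    (+ 1 - x) * G y 2 + x * G y 1 ∎
    where
    expand : ∀ x → (+ 1 - x) * (- x * (- x * (- x * - x - + 1)) - - x * - x) + + 1 * (- x * - x)
                   ≡ (+ 1 - x) * ((x * x) * (x * x - + 1)) + x * (x * x)
    expand = solve-∀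

sum1≡∑ : ∀ K (f : ℕ → ℤ) → sum1 K f ≡ ∑ K (λ b → f (suc b))
sum1≡∑ zero    f = refl
sum1≡∑ (suc K) f = trans (cong (_+ f (suc K)) (sum1≡∑ K f)) (sym (∑-last K (λ b → f (suc b))))

^-*2 : ∀ x a → x ^ (a ℕ.* 2) ≡ (x * x) ^ a
^-*2 x zero    = refl
^-*2 x (suc a) = trans (cong (λ e → x * (x * e)) (^-*2 x a)) (sym (ℤₚ.*-assoc x x _))

odd-exponent : ∀ a b → 3 ℕ.+ (a ℕ.+ b) ℕ.* 2 ∸ 2 ℕ.* suc b ≡ 1 ℕ.+ a ℕ.* 2
odd-exponent a b = trans (cong (_∸ 2 ℕ.* suc b) (split a b)) (ℕₚ.m+n∸n≡m (1 ℕ.+ a ℕ.* 2) (2 ℕ.* suc b))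
  where
  split : ∀ a b → 3 ℕ.+ (a ℕ.+ b) ℕ.* 2 ≡ 1 ℕ.+ a ℕ.* 2 ℕ.+ 2 ℕ.* suc b
  split = ℕ-Ring.solve-∀

quarter-beyond : ∀ k {b} → (3 ℕ.+ k ℕ.* 2) / 4 < b → suc k < b ℕ.+ b
quarter-beyond k {b} q<b = ℕₚ.*-cancelʳ-≤ (2 ℕ.+ k) (b ℕ.+ b) 2 (subst (4 ℕ.+ k ℕ.* 2 ≤_) (four b) below)
  where
  below : 3 ℕ.+ k ℕ.* 2 < b ℕ.* 4
  below = ℕₚ.≰⇒> λ b*4≤m →
    ℕₚ.<⇒≱ q<b (subst (_≤ (3 ℕ.+ k ℕ.* 2) / 4) (m*n/n≡m b 4) (/-monoˡ-≤ 4 b*4≤m))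
  four : ∀ b → b ℕ.* 4 ≡ (b ℕ.+ b) ℕ.* 2
  four = ℕ-Ring.solve-∀

quarter-below : ∀ J → (3 ℕ.+ (2 ℕ.+ J) ℕ.* 2) / 4 < 2 ℕ.+ J
quarter-below J =
  m<n*o⇒m/o<n {o = 4} (subst (3 ℕ.+ (2 ℕ.+ J) ℕ.* 2 <_) (sym (excess J)) (ℕₚ.m<m+n _ (s≤s z≤n)))
  where
  excess : ∀ J → (2 ℕ.+ J) ℕ.* 4 ≡ 3 ℕ.+ (2 ℕ.+ J) ℕ.* 2 ℕ.+ suc (J ℕ.* 2)
  excess = ℕ-Ring.solve-∀

oddTerm evenTerm : ℕ → ℤ → ℕ → ℤ
oddTerm n x k = sgn (k ∸ 1) * binom ((n ℕ.+ 1) / 2 ∸ k) (+ (k ∸ 1)) * x ^ (n ∸ 2 ℕ.* k ℕ.+ 2)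
evenTerm n x k =
  sgn (k ∸ 1) * (binom (n / 2 ℕ.+ 2 ∸ k) (+ k - + 1) ℤ.+ binom (n / 2 ℕ.+ 2 ∸ k) (+ k - + 2) * x)
    * x ^ (n ℕ.+ 3 ∸ 2 ℕ.* k)

oddTerm-sum : ∀ j x → sum1 ((3 ℕ.+ j ℕ.* 2) / 4 ℕ.+ 1) (oddTerm (3 ℕ.+ j ℕ.* 2) x) ≡ x * G (x * x) (suc j)
oddTerm-sum j x = begin
  sum1 L (oddTerm n x)
    ≡⟨ sum1≡∑ L (oddTerm n x) ⟩
  ∑ L (λ b → sgn b * binom ((n ℕ.+ 1) / 2 ∸ suc b) (+ b) * x ^ e b)
    ≡⟨ cong (λ h → ∑ L (λ b → sgn b * binom (h ∸ suc b) (+ b) * x ^ e b)) half ⟩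
  ∑ L (λ b → sgn b * + ((suc j ∸ b) C b) * x ^ e b)
    ≡⟨ binomialSum-from (suc j) (λ a → x * (x * x) ^ a) (λ b → x ^ e b) L≤ beyond agree ⟩
  binomialSum (λ a → x * (x * x) ^ a) (suc j)
    ≡⟨ binomialSum-scale (suc j) x ((x * x) ^_) _ (λ _ → refl) ⟩
  x * G (x * x) (suc j) ∎
  where
  open ≡-Reasoning
  n = 3 ℕ.+ j ℕ.* 2
  L = n / 4 ℕ.+ 1
  e : ℕ → ℕ
  e b = n ∸ 2 ℕ.* suc b ℕ.+ 2

  half : (n ℕ.+ 1) / 2 ≡ 2 ℕ.+ j
  half = trans (cong (_/ 2) (ℕₚ.+-comm n 1)) (m*n/n≡m (2 ℕ.+ j) 2)

  L≡ : L ≡ suc (n / 4)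
  L≡ = ℕₚ.+-comm (n / 4) 1

  L≤ : L ≤ suc (suc j)
  L≤ = subst (_≤ suc (suc j)) (sym L≡) (ℕₚ.≤-<-trans (/-monoˡ-≤ 4 (ℕₚ.m≤n+m n 4)) (quarter-below j))

  beyond : ∀ b → L ≤ b → suc j < b ℕ.+ b
  beyond b L≤b = quarter-beyond j (subst (_≤ b) L≡ L≤b)

  agree : ∀ a b → b ≤ a → a ℕ.+ b ≡ suc j → x ^ e b ≡ x * (x * x) ^ a
  agree zero    zero    _ ()
  agree zero    (suc b) () _
  agree (suc a) b       _ 1+a+b≡1+j = begin
    x ^ e b
      ≡⟨ cong (λ i → x ^ (3 ℕ.+ i ℕ.* 2 ∸ 2 ℕ.* suc b ℕ.+ 2)) (sym (ℕₚ.suc-injective 1+a+b≡1+j)) ⟩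
    x ^ (3 ℕ.+ (a ℕ.+ b) ℕ.* 2 ∸ 2 ℕ.* suc b ℕ.+ 2)
      ≡⟨ cong (λ m → x ^ (m ℕ.+ 2)) (odd-exponent a b) ⟩
    x ^ (1 ℕ.+ a ℕ.* 2 ℕ.+ 2)
      ≡⟨ cong (x ^_) (ℕₚ.+-comm (1 ℕ.+ a ℕ.* 2) 2) ⟩
    x * x ^ (suc a ℕ.* 2)
      ≡⟨ cong (x *_) (^-*2 x (suc a)) ⟩
    x * (x * x) ^ suc a ∎

module EvenSum (J : ℕ) (x : ℤ) where

  n q : ℕ
  n = 4 ℕ.+ J ℕ.* 2
  q = (n ℕ.+ 3) / 4

  e : ℕ → ℕ
  e b = n ℕ.+ 3 ∸ 2 ℕ.* suc b

  n+3≡ : n ℕ.+ 3 ≡ 3 ℕ.+ (2 ℕ.+ J) ℕ.* 2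
  n+3≡ = ℕₚ.+-comm n 3

  q<2+J : q < 2 ℕ.+ J
  q<2+J = subst (λ m → m / 4 < 2 ℕ.+ J) (sym n+3≡) (quarter-below J)

  beyond : ∀ {b} → q < b → 3 ℕ.+ J < b ℕ.+ b
  beyond {b} q<b = quarter-beyond (2 ℕ.+ J) (subst (λ m → m / 4 < b) n+3≡ q<b)

  exponent : ∀ a b → a ℕ.+ b ≡ 2 ℕ.+ J → e b ≡ 1 ℕ.+ a ℕ.* 2
  exponent a b a+b≡2+J =
    trans (cong (_∸ 2 ℕ.* suc b) (trans n+3≡ (cong (λ i → 3 ℕ.+ i ℕ.* 2) (sym a+b≡2+J)))) (odd-exponent a b)

  F₁ F₂ : ℕ → ℤ
  F₁ b = sgn b * + ((3 ℕ.+ J ∸ b) C b) * x ^ e b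
  F₂ b = sgn b * (binom (3 ℕ.+ J ∸ b) (+ suc b - + 2) * x) * x ^ e b

  split : ∀ b → evenTerm n x (suc b) ≡ F₁ b + F₂ b
  split b = begin
    sgn b * (binom (n / 2 ℕ.+ 2 ∸ suc b) (+ b) + binom (n / 2 ℕ.+ 2 ∸ suc b) (+ suc b - + 2) * x) * x ^ e b
      ≡⟨ cong (λ h → sgn b * (binom (h ∸ suc b) (+ b) + binom (h ∸ suc b) (+ suc b - + 2) * x) * x ^ e b) H≡ ⟩
    sgn b * (+ ((3 ℕ.+ J ∸ b) C b) + binom (3 ℕ.+ J ∸ b) (+ suc b - + 2) * x) * x ^ e b
      ≡⟨ distrib (sgn b) (+ ((3 ℕ.+ J ∸ b) C b)) (binom (3 ℕ.+ J ∸ b) (+ suc b - + 2) * x) (x ^ e b) ⟩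
    F₁ b + F₂ b ∎
    where
    open ≡-Reasoning
    H≡ : n / 2 ℕ.+ 2 ≡ 4 ℕ.+ J
    H≡ = trans (cong (ℕ._+ 2) (m*n/n≡m (2 ℕ.+ J) 2)) (ℕₚ.+-comm (2 ℕ.+ J) 2)
    distrib : ∀ s c c′ p → s * (c + c′) * p ≡ s * c * p + s * c′ * p
    distrib = solve-∀

  sum-F₁ : ∑ (2 ℕ.+ q) F₁ ≡ x * G (x * x) (2 ℕ.+ J) - x * G (x * x) (1 ℕ.+ J)
  sum-F₁ = begin
    ∑ (2 ℕ.+ q) F₁
      ≡⟨ binomialSum-from (3 ℕ.+ J) w (λ b → x ^ e b) (s≤s (s≤s (ℕₚ.<⇒≤ q<2+J)))
                          (λ b 2+q≤b → beyond (ℕₚ.≤-trans (ℕₚ.n≤1+n (suc q)) 2+q≤b)) agree ⟩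
    binomialSum w (2 ℕ.+ (1 ℕ.+ J))
      ≡⟨ binomialSum-pascal (1 ℕ.+ J) w ⟩
    binomialSum (λ a → w (suc a)) (2 ℕ.+ J) - binomialSum (λ a → w (suc a)) (1 ℕ.+ J)
      ≡⟨ cong₂ _-_ (binomialSum-scale (2 ℕ.+ J) x ((x * x) ^_) _ (λ a → cong (x *_) (^-*2 x a)))
                   (binomialSum-scale (1 ℕ.+ J) x ((x * x) ^_) _ (λ a → cong (x *_) (^-*2 x a))) ⟩
    x * G (x * x) (2 ℕ.+ J) - x * G (x * x) (1 ℕ.+ J) ∎
    where
    open ≡-Reasoning
    w : ℕ → ℤ
    w a = x ^ (a ℕ.* 2 ∸ 1)
    agree : ∀ a b → b ≤ a → a ℕ.+ b ≡ 3 ℕ.+ J → x ^ e b ≡ w a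
    agree zero    zero    _  ()
    agree zero    (suc b) () _
    agree (suc a) b       _  1+a+b≡3+J = cong (x ^_) (exponent a b (ℕₚ.suc-injective 1+a+b≡3+J))

  sum-F₂ : ∑ (2 ℕ.+ q) F₂ ≡ + 0 + - G (x * x) (2 ℕ.+ J)
  sum-F₂ = cong₂ _+_ (vanish x (x ^ e 0)) (begin
    ∑ (suc q) (λ b → F₂ (suc b))
      ≡⟨ ∑-cong (suc q) (λ b _ → shift (sgn b) (+ ((2 ℕ.+ J ∸ b) C b)) x (x ^ e (suc b))) ⟩
    ∑ (suc q) (λ b → - (sgn b * + ((2 ℕ.+ J ∸ b) C b) * (x * x ^ e (suc b))))
      ≡⟨ ∑-neg (suc q) (λ b → sgn b * + ((2 ℕ.+ J ∸ b) C b) * (x * x ^ e (suc b))) ⟩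
    - ∑ (suc q) (λ b → sgn b * + ((2 ℕ.+ J ∸ b) C b) * (x * x ^ e (suc b)))
      ≡⟨ cong -_ (binomialSum-from (2 ℕ.+ J) ((x * x) ^_) (λ b → x * x ^ e (suc b)) (s≤s (ℕₚ.<⇒≤ q<2+J))
                                   (λ b 1+q≤b → ℕₚ.<⇒≤ (beyond 1+q≤b)) agree) ⟩
    - G (x * x) (2 ℕ.+ J) ∎)
    where
    open ≡-Reasoning
    vanish : ∀ x p → + 1 * (+ 0 * x) * p ≡ + 0
    vanish = solve-∀
    shift : ∀ s c x p → - s * (c * x) * p ≡ - (s * c * (x * p))
    shift = solve-∀
    agree : ∀ a b → b ≤ a → a ℕ.+ b ≡ 2 ℕ.+ J → x * x ^ e (suc b) ≡ (x * x) ^ a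
    agree zero    zero    _  ()
    agree zero    (suc b) () _
    agree (suc a) b       _  a+b≡2+J =
      trans (cong (λ m → x * x ^ m) (exponent a (suc b) (trans (ℕₚ.+-suc a b) a+b≡2+J))) (^-*2 x (suc a))

-- The first binomial of the even summand gives a sum that Pascal's rule turns into
-- x (G_{J+2} − G_{J+1}); the second, shifted by one, gives −G_{J+2}.
evenTerm-sum : ∀ J x → - sum1 ((4 ℕ.+ J ℕ.* 2 ℕ.+ 3) / 4 ℕ.+ 2) (evenTerm (4 ℕ.+ J ℕ.* 2) x)
                         ≡ (+ 1 - x) * G (x * x) (2 ℕ.+ J) + x * G (x * x) (1 ℕ.+ J)
evenTerm-sum J x = begin
  - sum1 (q ℕ.+ 2) (evenTerm n x)
    ≡⟨ cong -_ (trans (sum1≡∑ (q ℕ.+ 2) (evenTerm n x))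
                      (cong (λ L → ∑ L (λ b → evenTerm n x (suc b))) (ℕₚ.+-comm q 2))) ⟩
  - ∑ (2 ℕ.+ q) (λ b → evenTerm n x (suc b))
    ≡⟨ cong -_ (trans (∑-cong (2 ℕ.+ q) (λ b _ → split b)) (∑-+ (2 ℕ.+ q) F₁ F₂)) ⟩
  - (∑ (2 ℕ.+ q) F₁ + ∑ (2 ℕ.+ q) F₂)
    ≡⟨ cong₂ (λ a b → - (a + b)) sum-F₁ sum-F₂ ⟩
  - (x * G (x * x) (2 ℕ.+ J) - x * G (x * x) (1 ℕ.+ J) + (+ 0 + - G (x * x) (2 ℕ.+ J)))
    ≡⟨ tidy x (G (x * x) (2 ℕ.+ J)) (G (x * x) (1 ℕ.+ J)) ⟩
  (+ 1 - x) * G (x * x) (2 ℕ.+ J) + x * G (x * x) (1 ℕ.+ J) ∎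
  where
  open ≡-Reasoning
  open EvenSum J x
  tidy : ∀ x g₂ g₁ → - (x * g₂ - x * g₁ + (+ 0 + - g₂)) ≡ (+ 1 - x) * g₂ + x * g₁
  tidy = solve-∀

odd-form : ∀ n → 3 ≤ n → n % 2 ≡ 1 → ∃ λ j → n ≡ 3 ℕ.+ j ℕ.* 2
odd-form n 3≤n n%2≡1 = from-half (n / 2) (trans (m≡m%n+[m/n]*n n 2) (cong (ℕ._+ n / 2 ℕ.* 2) n%2≡1))
  where
  from-half : ∀ h → n ≡ 1 ℕ.+ h ℕ.* 2 → ∃ λ j → n ≡ 3 ℕ.+ j ℕ.* 2
  from-half zero    n≡1 with subst (3 ≤_) n≡1 3≤n
  ... | s≤s ()
  from-half (suc j) n≡ = j , n≡

even-form : ∀ n → 3 ≤ n → n % 2 ≡ 0 → ∃ λ J → n ≡ 4 ℕ.+ J ℕ.* 2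
even-form n 3≤n n%2≡0 = from-half (n / 2) (trans (m≡m%n+[m/n]*n n 2) (cong (ℕ._+ n / 2 ℕ.* 2) n%2≡0))
  where
  from-half : ∀ h → n ≡ h ℕ.* 2 → ∃ λ J → n ≡ 4 ℕ.+ J ℕ.* 2
  from-half zero          n≡0 with subst (3 ≤_) n≡0 3≤n
  ... | ()
  from-half (suc zero)    n≡2 with subst (3 ≤_) n≡2 3≤n
  ... | s≤s (s≤s ())
  from-half (suc (suc J)) n≡  = J , n≡

lemma4p4 : (n : ℕ) → 3 ≤ n → (x : ℤ) →
    ((n % 2 ≡ 1) →
      Q n x ≡ (x - + 2) * sum1 (n / 4 ℕ.+ 1) (λ k →
        sgn (k ∸ 1) * binom ((n ℕ.+ 1) / 2 ∸ k) (+ (k ∸ 1)) * x ^ (n ∸ 2 ℕ.* k ℕ.+ 2)))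
    × ((n % 2 ≡ 0) →
      Q n x ≡ ℤ.- sum1 ((n ℕ.+ 3) / 4 ℕ.+ 2) (λ k →
        sgn (k ∸ 1) * (binom (n / 2 ℕ.+ 2 ∸ k) (+ k - + 1) ℤ.+ binom (n / 2 ℕ.+ 2 ∸ k) (+ k - + 2) * x)
          * x ^ (n ℕ.+ 3 ∸ 2 ℕ.* k)))
lemma4p4 n 3≤n x = odd-case , even-case
  where
  odd-case : n % 2 ≡ 1 → Q n x ≡ (x - + 2) * sum1 (n / 4 ℕ.+ 1) (oddTerm n x)
  odd-case n%2≡1 with (j , n≡) ← odd-form n 3≤n n%2≡1 =
    subst (λ m → Q m x ≡ (x - + 2) * sum1 (m / 4 ℕ.+ 1) (oddTerm m x)) (sym n≡)
          (trans (Q-odd j x) (cong ((x - + 2) *_) (sym (oddTerm-sum j x))))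

  even-case : n % 2 ≡ 0 → Q n x ≡ - sum1 ((n ℕ.+ 3) / 4 ℕ.+ 2) (evenTerm n x)
  even-case n%2≡0 with (J , n≡) ← even-form n 3≤n n%2≡0 =
    subst (λ m → Q m x ≡ - sum1 ((m ℕ.+ 3) / 4 ℕ.+ 2) (evenTerm m x)) (sym n≡)
          (trans (Q-even (suc J) x) (sym (evenTerm-sum J x)))
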